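{- Let $k$ be a positive integer, $j$ a nonnegative integer, and $\lambda$ a partition with $\lambda_1+\ell(\lambda)-1=k$ and smallest nonzero part $\lambda_{\ell(\lambda)}\geq j$. Then $B_\lambda f\in\Omega^{(k)}_{\lambda_1}$ for every $f\in\Omega^{(k)}_j$.
   Context: For $n\in\mathbb Z$, $B_n=\sum_{i\ge0}s_{i+n}[X]\,s_i[X(t-1)]^\perp$ acting on symmetric functions over $\mathbb Q(q,t)$ ($f^\perp$ adjoint to multiplication by $f$ for the Hall scalar product; $s_i[X(t-1)]$ the plethystic substitution $p_n\mapsto(t^n-1)p_n$); for a partition $\mu$ of length $L$, $B_\mu=\prod_{1\le a<b\le L}(1-te_{ab})B_{\mu_1}\cdots B_{\mu_L}$ with $e_{ab}$ raising the $a$-th index by one and lowering the $b$-th by one. Main hook-length: $h_M(\mu)=\mu_1+\ell(\mu)-1$. $k$-split: for a partition $\mu$ with $\mu_1\le k$, $\mu^{\to k}=(\mu^{(1)},\mu^{(2)},\dots,\mu^{(s)})$ is obtained by cutting $\mu$, without rearranging parts and starting from the largest parts, into consecutive blocks of rows $\mu^{(i)}$ with $h_M(\mu^{(i)})=k$ for all $i<s$ (the last block may have main hook-length less than $k$; if $h_M(\mu)\le k$ then $\mu^{\to k}=(\mu)$). The $k$-split polynomials are defined recursively by $G^{(k)}_{()}=1$ and $G^{(k)}_\mu[X;t]=B_{\mu^{(1)}}G^{(k)}_{(\mu^{(2)},\mu^{(3)},\dots)}[X;t]$, where $(\mu^{(2)},\mu^{(3)},\dots)$ is the partition formed by the remaining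 rows. For $0\le j\le k$, $\Omega^{(k)}_j$ is the linear span of $\{G^{(k)}_\mu[X;t]:\mu_1\le k,\ \mu_1=j\}$ (the empty partition has first part $0$). -}

module Defs where

open import Data.Nat using (ℕ; zero; suc; _≤_; _<_; _∸_; _⊔_; _⊓_; _≡ᵇ_; _≤ᵇ_; _!) renaming (_+_ to _+ℕ_; _*_ to _*ℕ_; _^_ to _^ℕ_)
open import Data.Integer using (ℤ; +_; -[1+_]; 0ℤ; 1ℤ; -_) renaming (_+_ to _+ℤ_; _*_ to _*ℤ_)
open import Data.Bool using (Bool; true; false; if_then_else_; _∧_)
open import Data.List using (List; []; _∷_; _++_; map; concatMap; foldr; length; take; drop; upTo)
open import Data.Nat.ListAction using (sum; product)
open import Data.List.Relation.Unary.All using (All)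
open import Data.List.Relation.Unary.Linked using (Linked)
open import Data.Product using (_×_; _,_; Σ)
open import Relation.Binary.PropositionalEquality using (_≡_)
open import Relation.Nullary using (¬_)

-- Polynomials in q, t with integer coefficients: formal lists of
-- monomials (c , a , b) meaning c q^a t^b; equality is coefficientwise.

Poly : Set
Poly = List (ℤ × ℕ × ℕ)

coeffP : Poly → ℕ → ℕ → ℤ
coeffP [] a b = 0ℤ
coeffP ((c , x , y) ∷ p) a b =
  (if (x ≡ᵇ a) ∧ (y ≡ᵇ b) then c else 0ℤ) +ℤ coeffP p a b

_≈P_ : Poly → Poly → Set
p ≈P r = ∀ a b → coeffP p a b ≡ coeffP r a b

_+P_ : Poly → Poly → Poly
p +P r = p ++ r

_*P_ : Poly → Poly → Poly
p *P r = concatMap (λ { (c , x , y) → map (λ { (d , u , v) → (c *ℤ d , x +ℕ u , y +ℕ v) }) r }) p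

negP : Poly → Poly
negP = map (λ { (c , x , y) → (- c , x , y) })

constP : ℤ → Poly
constP c = (c , 0 , 0) ∷ []

tP : Poly
tP = (1ℤ , 0 , 1) ∷ []

powP : Poly → ℕ → Poly
powP p zero = constP 1ℤ
powP p (suc n) = p *P powP p n

-- The field Q(q,t) as fractions num/den of such polynomials.

record Frac : Set where
  constructor _/_
  field
    num : Poly
    den : Poly
open Frac public

_≈F_ : Frac → Frac → Set
x ≈F y = (num x *P den y) ≈P (num y *P den x)

ValidF : Frac → Set
ValidF x = ¬ (den x ≈P [])

_+F_ : Frac → Frac → Frac
(a / b) +F (c / d) = ((a *P d) +P (c *P b)) / (b *P d)

_*F_ : Frac → Frac → Frac
(a / b) *F (c / d) = (a *P c) / (b *P d)

0F 1F : Frac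
0F = [] / constP 1ℤ
1F = constP 1ℤ / constP 1ℤ

polyF : Poly → Frac
polyF p = p / constP 1ℤ

natF : ℕ → Frac
natF n = polyF (constP (+ n))

-- Symmetric functions over Q(q,t), in the power-sum basis:
-- formal lists of terms (c , ρ) meaning c p_ρ, with ρ a weakly
-- decreasing list of positive integers.  Equality is coefficientwise.

Sym : Set
Sym = List (Frac × List ℕ)

eqListᵇ : List ℕ → List ℕ → Bool
eqListᵇ [] [] = true
eqListᵇ [] (_ ∷ _) = false
eqListᵇ (_ ∷ _) [] = false
eqListᵇ (x ∷ xs) (y ∷ ys) = (x ≡ᵇ y) ∧ eqListᵇ xs ys

coeffS : Sym → List ℕ → Frac
coeffS [] ρ = 0F
coeffS ((c , σ) ∷ f) ρ = (if eqListᵇ σ ρ then c else 0F) +F coeffS f ρ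

_≈S_ : Sym → Sym → Set
f ≈S g = ∀ ρ → coeffS f ρ ≈F coeffS g ρ

ValidS : Sym → Set
ValidS f = All (λ { (c , _) → ValidF c }) f

oneS : Sym
oneS = (1F , []) ∷ []

scaleS : Frac → Sym → Sym
scaleS c = map (λ { (d , ρ) → (c *F d , ρ) })

insertD : ℕ → List ℕ → List ℕ
insertD n [] = n ∷ []
insertD n (m ∷ ρ) = if n ≤ᵇ m then m ∷ insertD n ρ else n ∷ m ∷ ρ

mergeD : List ℕ → List ℕ → List ℕ
mergeD ρ σ = foldr insertD σ ρ

mulS : Sym → Sym → Sym
mulS f g = concatMap (λ { (c , ρ) → map (λ { (d , σ) → (c *F d , mergeD ρ σ) }) g }) f

count : ℕ → List ℕ → ℕ
count n [] = 0
count n (m ∷ ρ) = (if n ≡ᵇ m then 1 else 0) +ℕ count n ρ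

remove1 : ℕ → List ℕ → List ℕ
remove1 n [] = []
remove1 n (m ∷ ρ) = if n ≡ᵇ m then ρ else m ∷ remove1 n ρ

dS : ℕ → Sym → Sym
dS n = map (λ { (c , ρ) → (c *F natF (count n ρ) , remove1 n ρ) })

-- p_ρ^⊥ = ∏_j ρ_j ∂/∂p_{ρ_j}
pPerp : List ℕ → Sym → Sym
pPerp ρ f = foldr (λ n g → scaleS (natF n) (dS n g)) f ρ

-- partitions of m (as weakly decreasing lists) with parts ≤ b
partsB : ℕ → ℕ → ℕ → List (List ℕ)
partsB _ zero b = [] ∷ []
partsB zero (suc m) b = []
partsB (suc fuel) (suc m) b =
  concatMap (λ a → map (a ∷_) (partsB fuel (suc m ∸ a) a)) (map suc (upTo (suc m ⊓ b)))

partitionsOf : ℕ → List (List ℕ)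
partitionsOf m = partsB m m m

zee : List ℕ → ℕ
zee ρ = product (map (λ i → (i ^ℕ count i ρ) *ℕ (count i ρ) !) (map suc (upTo (sum ρ))))

-- Schur function s_m = Σ_{ρ ⊢ m} z_ρ^{-1} p_ρ ; s_m = 0 for m < 0
schurN : ℕ → Sym
schurN m = map (λ ρ → (constP 1ℤ / constP (+ zee ρ) , ρ)) (partitionsOf m)

schurZ : ℤ → Sym
schurZ (+ m) = schurN m
schurZ -[1+ m ] = []

-- s_i[X(t-1)]^⊥ = Σ_{ρ ⊢ i} z_ρ^{-1} ∏_j (t^{ρ_j} - 1) p_ρ^⊥
tm1 : ℕ → Poly
tm1 n = (1ℤ , 0 , n) ∷ (- 1ℤ , 0 , 0) ∷ []

plethCoef : List ℕ → Frac
plethCoef ρ = foldr (λ n p → tm1 n *P p) (constP 1ℤ) ρ / constP (+ zee ρ)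

skewT : ℕ → Sym → Sym
skewT i f = concatMap (λ ρ → scaleS (plethCoef ρ) (pPerp ρ f)) (partitionsOf i)

degS : Sym → ℕ
degS [] = 0
degS ((_ , ρ) ∷ f) = sum ρ ⊔ degS f

-- B_n f = Σ_{i ≥ 0} s_{i+n}[X] s_i[X(t-1)]^⊥ f  (finite sum on f)
Bop : ℤ → Sym → Sym
Bop n f = concatMap (λ i → mulS (schurZ ((+ i) +ℤ n)) (skewT i f)) (upTo (suc (degS f)))

Bseq : List ℤ → Sym → Sym
Bseq [] f = f
Bseq (n ∷ ν) f = Bop n (Bseq ν f)

-- Raising operators: ∏_{a<b} (1 - t e_ab) expanded as a sum over
-- subsets S of pairs a<b of (-t)^{|S|} times the shifted index.

adjust : ℕ → (ℤ → ℤ) → List ℤ → List ℤ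
adjust _ g [] = []
adjust zero g (x ∷ xs) = g x ∷ xs
adjust (suc i) g (x ∷ xs) = x ∷ adjust i g xs

pairsLt : ℕ → List (ℕ × ℕ)
pairsLt L = concatMap (λ b → map (λ a → (a , b)) (upTo b)) (upTo L)

subsets : {A : Set} → List A → List (List A)
subsets [] = [] ∷ []
subsets (x ∷ xs) = subsets xs ++ map (x ∷_) (subsets xs)

applyPairs : List (ℕ × ℕ) → List ℤ → List ℤ
applyPairs S ν = foldr (λ { (a , b) v → adjust a (λ x → x +ℤ 1ℤ) (adjust b (λ x → x +ℤ (- 1ℤ)) v) }) ν S

Bμ : List ℕ → Sym → Sym
Bμ μ f = concatMap
  (λ S → scaleS (polyF (powP (negP tP) (length S))) (Bseq (applyPairs S (map +_ μ)) f))
  (subsets (pairsLt (length μ)))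

IsPartition : List ℕ → Set
IsPartition μ = All (0 <_) μ × Linked (λ a b → b ≤ a) μ

headP : List ℕ → ℕ
headP [] = 0
headP (x ∷ _) = x

lastP : List ℕ → ℕ
lastP [] = 0
lastP (x ∷ []) = x
lastP (_ ∷ y ∷ ys) = lastP (y ∷ ys)

-- the first block of μ^{→k} has k + 1 - μ_1 rows (or all rows, if fewer)
Gfuel : ℕ → ℕ → List ℕ → Sym
Gfuel _ k [] = oneS
Gfuel zero k (_ ∷ _) = oneS
Gfuel (suc fuel) k (m ∷ μ) =
  Bμ (take (suc (k ∸ m)) (m ∷ μ)) (Gfuel fuel k (drop (suc (k ∸ m)) (m ∷ μ)))

-- G^{(k)}_μ[X;t]  (meaningful for μ_1 ≤ k)
G : ℕ → List ℕ → Sym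
G k μ = Gfuel (length μ) k μ

evalG : ℕ → List (Frac × List ℕ) → Sym
evalG k cs = concatMap (λ { (c , μ) → scaleS c (G k μ) }) cs

InΩ : ℕ → ℕ → Sym → Set
InΩ k j f = Σ (List (Frac × List ℕ)) λ cs →
  All (λ { (c , μ) → ValidF c × IsPartition μ × headP μ ≤ k × headP μ ≡ j }) cs
  × (f ≈S evalG k cs)

-- If λ has main hook-length k and μ is a partition with μ₁ ≤ λ_ℓ, the k-split of the concatenation λμ
-- begins with the block λ, so G^{(k)}_{λμ} = B_λ G^{(k)}_μ, and λμ has first part λ₁. Hence B_λ maps the
-- spanning set of Ω^{(k)}_j into Ω^{(k)}_{λ₁}, and the theorem follows once B_λ is known to be linear and
-- to respect equality of symmetric functions.
--
-- Symmetric functions are formal sums of terms c p_ρ, with c a formal quotient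
-- of polynomials in ℤ[q,t], compared coefficientwise by cross-multiplication. This equality is transitive
-- because ℤ[q,t] has no zero divisors (compare lexicographically leading monomials), so the fractions with
-- nonzero denominator form a commutative ring in which coefficients can be computed. Every operator involved
-- (∂/∂p_n, p_ρ^⊥, multiplication, s_i[X(t-1)]^⊥, B_n, B_μ) is then shown to satisfy T f = Σ c_σ T(p_σ) for
-- f = Σ c_σ p_σ. For B_n, whose sum over i is truncated at a degree bound read off the representation of f,
-- this needs the extra terms to vanish.

module Submission where

open import Defs
open import Data.Nat using (ℕ; suc; _≤_; _+_)
open import Data.List using (List; length)
open import Relation.Binary.PropositionalEquality using (_≡_)

open import Algebra.Bundles using (CommutativeRing)
import Algebra.Properties.CommutativeSemigroup as CommutativeSemigroupProperties
import Algebra.Solver.Ring as RingSolver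
open import Algebra.Solver.Ring.AlmostCommutativeRing using (fromCommutativeRing; -raw-almostCommutative⟶)
open import Data.Bool using (true; false; if_then_else_; _∧_)
open import Data.Bool.Properties using (∧-zeroʳ)
open import Data.Empty using (⊥-elim)
open import Data.Integer using (ℤ; +_; -[1+_]; 0ℤ; 1ℤ; -_) renaming (_+_ to _+ℤ_; _*_ to _*ℤ_)
import Data.Integer.Properties as ℤ
open import Data.List using ([]; _∷_; _++_; map; concatMap; upTo; take; drop)
open import Data.List.Membership.Propositional using (_∈_)
import Data.List.Properties as List
open import Data.List.Relation.Unary.All as All using (All; []; _∷_)
import Data.List.Relation.Unary.All.Properties as All
open import Data.List.Relation.Unary.Any using (here; there)
open import Data.List.Relation.Unary.Linked using (Linked; [-]; _∷_)
open import Data.Maybe using (nothing)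
open import Data.Nat using (zero; _<_; _∸_; _*_; _^_; _!; _⊓_; _≡ᵇ_; _≟_; _≤?_; z≤n; s≤s; NonZero; >-nonZero⁻¹)
open import Data.Nat.ListAction using (sum)
open import Data.Nat.ListAction.Properties using (product≢0)
import Data.Nat.Properties as ℕ
open import Data.Product using (_×_; _,_; proj₁; proj₂; Σ; ∃)
open import Data.Product.Properties using (≡-dec)
open import Data.Product.Relation.Binary.Lex.Strict using (×-strictTotalOrder)
open import Data.Sum using (_⊎_; inj₁; inj₂)
open import Data.Unit using (tt)
open import Function using (_$_; _∘_; const)
open import Level using (0ℓ)
open import Relation.Binary.Bundles using (StrictTotalOrder)
open import Relation.Binary.Definitions using (tri<; tri≈; tri>)
open import Relation.Binary.PropositionalEquality using (_≢_; refl; sym; trans; cong; cong₂; subst; subst₂; module ≡-Reasoning)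
import Relation.Binary.Reasoning.Setoid as SetoidReasoning
open import Relation.Nullary using (¬_; Dec; yes; no; does; _×-dec_)
open import Relation.Nullary.Decidable using (dec-true; dec-false)

-- Finite sums over lists in a commutative ring

module ListSum {c ℓ} (R : CommutativeRing c ℓ) where

  open CommutativeRing R renaming (_+_ to _+ᴿ_; _*_ to _*ᴿ_; refl to ≈-refl; sym to ≈-sym; trans to ≈-trans)
  open CommutativeSemigroupProperties +-commutativeSemigroup using (interchange)

  ∑ : {A : Set} → List A → (A → Carrier) → Carrier
  ∑ []       f = 0#
  ∑ (x ∷ xs) f = f x +ᴿ ∑ xs f

  module _ {A : Set} where

    ∑-cong : (xs : List A) {f g : A → Carrier} → (∀ x → f x ≈ g x) → ∑ xs f ≈ ∑ xs g
    ∑-cong []       f≈g = ≈-refl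
    ∑-cong (x ∷ xs) f≈g = +-cong (f≈g x) (∑-cong xs f≈g)

    ∑-congᴬ : {P : A → Set} {xs : List A} {f g : A → Carrier} →
              All P xs → (∀ x → P x → f x ≈ g x) → ∑ xs f ≈ ∑ xs g
    ∑-congᴬ []         f≈g = ≈-refl
    ∑-congᴬ (px ∷ pxs) f≈g = +-cong (f≈g _ px) (∑-congᴬ pxs f≈g)

    ∑-zero : (xs : List A) {f : A → Carrier} → (∀ x → f x ≈ 0#) → ∑ xs f ≈ 0#
    ∑-zero []       f≈0 = ≈-refl
    ∑-zero (x ∷ xs) f≈0 = ≈-trans (+-cong (f≈0 x) (∑-zero xs f≈0)) (+-identityˡ 0#)

    ∑-++ : (xs ys : List A) (f : A → Carrier) → ∑ (xs ++ ys) f ≈ ∑ xs f +ᴿ ∑ ys f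
    ∑-++ []       ys f = ≈-sym (+-identityˡ (∑ ys f))
    ∑-++ (x ∷ xs) ys f = ≈-trans (+-cong ≈-refl (∑-++ xs ys f)) (≈-sym (+-assoc (f x) (∑ xs f) (∑ ys f)))

    ∑-+ : (xs : List A) (f g : A → Carrier) → ∑ xs (λ x → f x +ᴿ g x) ≈ ∑ xs f +ᴿ ∑ xs g
    ∑-+ []       f g = ≈-sym (+-identityˡ 0#)
    ∑-+ (x ∷ xs) f g = ≈-trans (+-cong ≈-refl (∑-+ xs f g)) (interchange (f x) (g x) (∑ xs f) (∑ xs g))

    *-∑ : (a : Carrier) (xs : List A) (f : A → Carrier) → a *ᴿ ∑ xs f ≈ ∑ xs (λ x → a *ᴿ f x)
    *-∑ a []       f = zeroʳ a
    *-∑ a (x ∷ xs) f = ≈-trans (distribˡ a (f x) (∑ xs f)) (+-cong ≈-refl (*-∑ a xs f))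

  ∑-map : {A B : Set} (h : A → B) (xs : List A) (f : B → Carrier) → ∑ (map h xs) f ≡ ∑ xs (λ x → f (h x))
  ∑-map h []       f = refl
  ∑-map h (x ∷ xs) f = cong (f (h x) +ᴿ_) (∑-map h xs f)

  ∑-concatMap : {A B : Set} (g : A → List B) (xs : List A) (f : B → Carrier) →
                ∑ (concatMap g xs) f ≈ ∑ xs (λ x → ∑ (g x) f)
  ∑-concatMap g []       f = ≈-refl
  ∑-concatMap g (x ∷ xs) f = ≈-trans (∑-++ (g x) (concatMap g xs) f) (+-cong ≈-refl (∑-concatMap g xs f))

  ∑-comm : {A B : Set} (xs : List A) (ys : List B) (f : A → B → Carrier) →
           ∑ xs (λ x → ∑ ys (f x)) ≈ ∑ ys (λ y → ∑ xs (λ x → f x y))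
  ∑-comm []       ys f = ≈-sym (∑-zero ys (λ _ → ≈-refl))
  ∑-comm (x ∷ xs) ys f = ≈-trans (+-cong ≈-refl (∑-comm xs ys f)) (≈-sym (∑-+ ys (f x) (λ y → ∑ xs (λ x′ → f x′ y))))

-- The polynomial ring ℤ[q,t]

module ℤ∑ = ListSum ℤ.+-*-commutativeRing

Monomial : Set
Monomial = ℤ × ℕ × ℕ

exponent : Monomial → ℕ × ℕ
exponent (_ , x , y) = (x , y)

coeffM : ℕ → ℕ → Monomial → ℤ
coeffM a b (c , x , y) = if (x ≡ᵇ a) ∧ (y ≡ᵇ b) then c else 0ℤ

_*M_ : Monomial → Monomial → Monomial
(c , x , y) *M (d , u , v) = (c *ℤ d , x + u , y + v)

when : {P : Set} → Dec P → ℤ → ℤ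
when (yes _) z = z
when (no _)  z = 0ℤ

unless : {P : Set} → Dec P → ℤ → ℤ
unless (yes _) z = 0ℤ
unless (no _)  z = z

when+unless : {P : Set} (D : Dec P) (z : ℤ) → z ≡ when D z +ℤ unless D z
when+unless (yes _) z = sym (ℤ.+-identityʳ z)
when+unless (no _)  z = sym (ℤ.+-identityˡ z)

when-∑ : {A P : Set} (D : Dec P) (xs : List A) (f : A → ℤ) → when D (ℤ∑.∑ xs f) ≡ ℤ∑.∑ xs (λ x → when D (f x))
when-∑ (yes _) xs f = refl
when-∑ (no _)  xs f = sym (ℤ∑.∑-zero xs (λ _ → refl))

when-* : {P : Set} (D : Dec P) (d z : ℤ) → when D (d *ℤ z) ≡ d *ℤ when D z
when-* (yes _) d z = refl
when-* (no _)  d z = sym (ℤ.*-zeroʳ d)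

when-0 : {P : Set} (D : Dec P) → when D 0ℤ ≡ 0ℤ
when-0 (yes _) = refl
when-0 (no _)  = refl

coeffP≡∑ : (p : Poly) (a b : ℕ) → coeffP p a b ≡ ℤ∑.∑ p (coeffM a b)
coeffP≡∑ []      a b = refl
coeffP≡∑ (m ∷ p) a b = cong (coeffM a b m +ℤ_) (coeffP≡∑ p a b)

coeffP-++ : (p r : Poly) (a b : ℕ) → coeffP (p ++ r) a b ≡ coeffP p a b +ℤ coeffP r a b
coeffP-++ p r a b = begin
  coeffP (p ++ r) a b                   ≡⟨ coeffP≡∑ (p ++ r) a b ⟩
  ℤ∑.∑ (p ++ r) (coeffM a b)            ≡⟨ ℤ∑.∑-++ p r (coeffM a b) ⟩
  ℤ∑.∑ p (coeffM a b) +ℤ ℤ∑.∑ r (coeffM a b) ≡⟨ sym (cong₂ _+ℤ_ (coeffP≡∑ p a b) (coeffP≡∑ r a b)) ⟩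
  coeffP p a b +ℤ coeffP r a b          ∎
  where open ≡-Reasoning

coeffP-negP : (p : Poly) (a b : ℕ) → coeffP (negP p) a b ≡ - coeffP p a b
coeffP-negP []            a b = refl
coeffP-negP (m@(c , x , y) ∷ p) a b
  rewrite coeffP-negP p a b | ℤ.neg-distrib-+ (coeffM a b m) (coeffP p a b)
  with (x ≡ᵇ a) ∧ (y ≡ᵇ b)
... | true  = refl
... | false = refl

∑-*P : (p r : Poly) (f : Monomial → ℤ) → ℤ∑.∑ (p *P r) f ≡ ℤ∑.∑ p (λ m → ℤ∑.∑ r (λ n → f (m *M n)))
∑-*P p r f = trans (ℤ∑.∑-concatMap _ p f) (ℤ∑.∑-cong p (λ m → ℤ∑.∑-map (m *M_) r f))

coeffP-*P : (p r : Poly) (a b : ℕ) → coeffP (p *P r) a b ≡ ℤ∑.∑ p (λ m → ℤ∑.∑ r (λ n → coeffM a b (m *M n)))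
coeffP-*P p r a b = trans (coeffP≡∑ (p *P r) a b) (∑-*P p r (coeffM a b))

x+u≡ᵇa≡u≡ᵇa∸x : ∀ x u a → x ≤ a → (x + u ≡ᵇ a) ≡ (u ≡ᵇ a ∸ x)
x+u≡ᵇa≡u≡ᵇa∸x zero    u a       _         = refl
x+u≡ᵇa≡u≡ᵇa∸x (suc x) u (suc a) (s≤s x≤a) = x+u≡ᵇa≡u≡ᵇa∸x x u a x≤a

x+u≡ᵇa≡false : ∀ x u a → ¬ x ≤ a → (x + u ≡ᵇ a) ≡ false
x+u≡ᵇa≡false x u a x≰a = dec-false (x + u ≟ a) (λ x+u≡a → x≰a (subst (x ≤_) x+u≡a (ℕ.m≤m+n x u)))

below? : (x y a b : ℕ) → Dec (x ≤ a × y ≤ b)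
below? x y a b = x ≤? a ×-dec y ≤? b

coeffM-*M : (c : ℤ) (x y a b : ℕ) (n : Monomial) →
            coeffM a b ((c , x , y) *M n) ≡ c *ℤ when (below? x y a b) (coeffM (a ∸ x) (b ∸ y) n)
coeffM-*M c x y a b (d , u , v) with x ≤? a | y ≤? b
... | yes x≤a | yes y≤b rewrite x+u≡ᵇa≡u≡ᵇa∸x x u a x≤a | x+u≡ᵇa≡u≡ᵇa∸x y v b y≤b
  with (u ≡ᵇ a ∸ x) ∧ (v ≡ᵇ b ∸ y)
...   | true  = refl
...   | false = sym (ℤ.*-zeroʳ c)
coeffM-*M c x y a b (d , u , v) | no x≰a | _ rewrite x+u≡ᵇa≡false x u a x≰a = sym (ℤ.*-zeroʳ c)
coeffM-*M c x y a b (d , u , v) | yes _ | no y≰b rewrite x+u≡ᵇa≡false y v b y≰b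
  with x + u ≡ᵇ a
...   | true  = sym (ℤ.*-zeroʳ c)
...   | false = sym (ℤ.*-zeroʳ c)

∑-coeffM-*M : (c : ℤ) (x y : ℕ) (r : Poly) (a b : ℕ) →
              ℤ∑.∑ r (λ n → coeffM a b ((c , x , y) *M n)) ≡ c *ℤ when (below? x y a b) (coeffP r (a ∸ x) (b ∸ y))
∑-coeffM-*M c x y r a b = begin
  ℤ∑.∑ r (λ n → coeffM a b ((c , x , y) *M n))              ≡⟨ ℤ∑.∑-cong r (coeffM-*M c x y a b) ⟩
  ℤ∑.∑ r (λ n → c *ℤ when D (coeffM (a ∸ x) (b ∸ y) n))      ≡⟨ sym (ℤ∑.*-∑ c r _) ⟩
  c *ℤ ℤ∑.∑ r (λ n → when D (coeffM (a ∸ x) (b ∸ y) n))      ≡⟨ cong (c *ℤ_) (sym (when-∑ D r _)) ⟩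
  c *ℤ when D (ℤ∑.∑ r (coeffM (a ∸ x) (b ∸ y)))              ≡⟨ cong (λ s → c *ℤ when D s) (sym (coeffP≡∑ r _ _)) ⟩
  c *ℤ when D (coeffP r (a ∸ x) (b ∸ y))                     ∎
  where
  open ≡-Reasoning
  D : Dec (x ≤ a × y ≤ b)
  D = below? x y a b

coeffM-*M-comm : ∀ m n a b → coeffM a b (m *M n) ≡ coeffM a b (n *M m)
coeffM-*M-comm (c , x , y) (d , u , v) a b rewrite ℤ.*-comm c d | ℕ.+-comm x u | ℕ.+-comm y v = refl

coeffM-*M-assoc : ∀ m n o a b → coeffM a b ((m *M n) *M o) ≡ coeffM a b (m *M (n *M o))
coeffM-*M-assoc (c , x , y) (d , u , v) (e , w , z) a b
  rewrite ℤ.*-assoc c d e | ℕ.+-assoc x u w | ℕ.+-assoc y v z = refl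

*P-comm : (p r : Poly) → (p *P r) ≈P (r *P p)
*P-comm p r a b = begin
  coeffP (p *P r) a b                                   ≡⟨ coeffP-*P p r a b ⟩
  ℤ∑.∑ p (λ m → ℤ∑.∑ r (λ n → coeffM a b (m *M n)))     ≡⟨ ℤ∑.∑-comm p r _ ⟩
  ℤ∑.∑ r (λ n → ℤ∑.∑ p (λ m → coeffM a b (m *M n)))
    ≡⟨ ℤ∑.∑-cong r (λ n → ℤ∑.∑-cong p (λ m → coeffM-*M-comm m n a b)) ⟩
  ℤ∑.∑ r (λ n → ℤ∑.∑ p (λ m → coeffM a b (n *M m)))     ≡⟨ sym (coeffP-*P r p a b) ⟩
  coeffP (r *P p) a b                                   ∎
  where open ≡-Reasoning

*P-assoc : (p r s : Poly) → ((p *P r) *P s) ≈P (p *P (r *P s))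
*P-assoc p r s a b = begin
  coeffP ((p *P r) *P s) a b                                                ≡⟨ coeffP-*P (p *P r) s a b ⟩
  ℤ∑.∑ (p *P r) (λ mn → ℤ∑.∑ s (λ o → coeffM a b (mn *M o)))                ≡⟨ ∑-*P p r _ ⟩
  ℤ∑.∑ p (λ m → ℤ∑.∑ r (λ n → ℤ∑.∑ s (λ o → coeffM a b ((m *M n) *M o))))
    ≡⟨ ℤ∑.∑-cong p (λ m → ℤ∑.∑-cong r (λ n → ℤ∑.∑-cong s (λ o → coeffM-*M-assoc m n o a b))) ⟩
  ℤ∑.∑ p (λ m → ℤ∑.∑ r (λ n → ℤ∑.∑ s (λ o → coeffM a b (m *M (n *M o)))))   ≡⟨ ℤ∑.∑-cong p (λ m → sym (∑-*P r s _)) ⟩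
  ℤ∑.∑ p (λ m → ℤ∑.∑ (r *P s) (λ no → coeffM a b (m *M no)))                ≡⟨ sym (coeffP-*P p (r *P s) a b) ⟩
  coeffP (p *P (r *P s)) a b                                                ∎
  where open ≡-Reasoning

*P-congʳ : (p : Poly) {r r′ : Poly} → r ≈P r′ → (p *P r) ≈P (p *P r′)
*P-congʳ p {r} {r′} r≈r′ a b = begin
  coeffP (p *P r) a b                                 ≡⟨ coeffP-*P p r a b ⟩
  ℤ∑.∑ p (λ m → ℤ∑.∑ r (λ n → coeffM a b (m *M n)))   ≡⟨ ℤ∑.∑-cong p shifted ⟩
  ℤ∑.∑ p (λ m → ℤ∑.∑ r′ (λ n → coeffM a b (m *M n)))  ≡⟨ sym (coeffP-*P p r′ a b) ⟩
  coeffP (p *P r′) a b                                ∎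
  where
  open ≡-Reasoning
  shifted : ∀ m → ℤ∑.∑ r (λ n → coeffM a b (m *M n)) ≡ ℤ∑.∑ r′ (λ n → coeffM a b (m *M n))
  shifted (c , x , y) = begin
    ℤ∑.∑ r (λ n → coeffM a b ((c , x , y) *M n))      ≡⟨ ∑-coeffM-*M c x y r a b ⟩
    c *ℤ when (below? x y a b) (coeffP r (a ∸ x) (b ∸ y))
      ≡⟨ cong (λ s → c *ℤ when (below? x y a b) s) (r≈r′ (a ∸ x) (b ∸ y)) ⟩
    c *ℤ when (below? x y a b) (coeffP r′ (a ∸ x) (b ∸ y)) ≡⟨ sym (∑-coeffM-*M c x y r′ a b) ⟩
    ℤ∑.∑ r′ (λ n → coeffM a b ((c , x , y) *M n))     ∎

*P-identityˡ : (p : Poly) → (constP 1ℤ *P p) ≈P p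
*P-identityˡ p a b = begin
  coeffP (constP 1ℤ *P p) a b                             ≡⟨ coeffP-*P (constP 1ℤ) p a b ⟩
  ℤ∑.∑ p (λ n → coeffM a b ((1ℤ , 0 , 0) *M n)) +ℤ 0ℤ     ≡⟨ ℤ.+-identityʳ _ ⟩
  ℤ∑.∑ p (λ n → coeffM a b ((1ℤ , 0 , 0) *M n))
    ≡⟨ ℤ∑.∑-cong p (λ { (d , u , v) → cong (λ e → coeffM a b (e , u , v)) (ℤ.*-identityˡ d) }) ⟩
  ℤ∑.∑ p (coeffM a b)                                     ≡⟨ sym (coeffP≡∑ p a b) ⟩
  coeffP p a b                                            ∎
  where open ≡-Reasoning

*P-distribˡ : (p r s : Poly) → (p *P (r ++ s)) ≈P ((p *P r) ++ (p *P s))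
*P-distribˡ p r s a b = begin
  coeffP (p *P (r ++ s)) a b                                ≡⟨ coeffP-*P p (r ++ s) a b ⟩
  ℤ∑.∑ p (λ m → ℤ∑.∑ (r ++ s) (F m))                        ≡⟨ ℤ∑.∑-cong p (λ m → ℤ∑.∑-++ r s (F m)) ⟩
  ℤ∑.∑ p (λ m → ℤ∑.∑ r (F m) +ℤ ℤ∑.∑ s (F m))               ≡⟨ ℤ∑.∑-+ p _ _ ⟩
  ℤ∑.∑ p (λ m → ℤ∑.∑ r (F m)) +ℤ ℤ∑.∑ p (λ m → ℤ∑.∑ s (F m))
    ≡⟨ sym (cong₂ _+ℤ_ (coeffP-*P p r a b) (coeffP-*P p s a b)) ⟩
  coeffP (p *P r) a b +ℤ coeffP (p *P s) a b                ≡⟨ sym (coeffP-++ (p *P r) (p *P s) a b) ⟩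
  coeffP ((p *P r) ++ (p *P s)) a b                         ∎
  where
  open ≡-Reasoning
  F : Monomial → Monomial → ℤ
  F m n = coeffM a b (m *M n)

-- A record rather than _≈P_ itself, so that Agda can infer the two polynomials from a proof.
record _≋_ (p r : Poly) : Set where
  constructor ≈P⇒≋
  field ≋⇒≈P : p ≈P r
open _≋_ public

infix 4 _≋_

+P-cong : {p p′ r r′ : Poly} → p ≋ p′ → r ≋ r′ → (p +P r) ≋ (p′ +P r′)
+P-cong {p} {p′} {r} {r′} (≈P⇒≋ p≈p′) (≈P⇒≋ r≈r′) = ≈P⇒≋ (λ a b →
  trans (coeffP-++ p r a b) (trans (cong₂ _+ℤ_ (p≈p′ a b) (r≈r′ a b)) (sym (coeffP-++ p′ r′ a b))))

negP-cong : {p p′ : Poly} → p ≋ p′ → negP p ≋ negP p′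
negP-cong {p} {p′} (≈P⇒≋ p≈p′) = ≈P⇒≋ (λ a b →
  trans (coeffP-negP p a b) (trans (cong -_ (p≈p′ a b)) (sym (coeffP-negP p′ a b))))

≋-refl : {p : Poly} → p ≋ p
≋-refl = ≈P⇒≋ (λ _ _ → refl)

≋-sym : {p r : Poly} → p ≋ r → r ≋ p
≋-sym (≈P⇒≋ p≈r) = ≈P⇒≋ (λ a b → sym (p≈r a b))

≋-trans : {p r s : Poly} → p ≋ r → r ≋ s → p ≋ s
≋-trans (≈P⇒≋ p≈r) (≈P⇒≋ r≈s) = ≈P⇒≋ (λ a b → trans (p≈r a b) (r≈s a b))

Poly-commutativeRing : CommutativeRing 0ℓ 0ℓ
Poly-commutativeRing = record
  { Carrier = Poly ; _≈_ = _≋_ ; _+_ = _+P_ ; _*_ = _*P_ ; -_ = negP ; 0# = [] ; 1# = constP 1ℤ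
  ; isCommutativeRing = record
    { isRing = record
      { +-isAbelianGroup = record
        { isGroup = record
          { isMonoid = record
            { isSemigroup = record
              { isMagma = record
                { isEquivalence = record { refl = ≋-refl ; sym = ≋-sym ; trans = ≋-trans }
                ; ∙-cong = +P-cong }
              ; assoc = λ p r s → ≡⇒≋ (List.++-assoc p r s) }
            ; identity = (λ _ → ≋-refl) , (λ p → ≡⇒≋ (List.++-identityʳ p)) }
          ; inverse = (λ p → ≋-trans (+-comm (negP p) p) (inverseʳ p)) , inverseʳ
          ; ⁻¹-cong = negP-cong }
        ; comm = +-comm }
      ; *-cong = λ {p} {p′} {r} {r′} (≈P⇒≋ e) (≈P⇒≋ f) →
                   ≋-trans (*-comm p r) (≋-trans (≈P⇒≋ (*P-congʳ r e)) (≋-trans (*-comm r p′) (≈P⇒≋ (*P-congʳ p′ f))))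
      ; *-assoc = λ p r s → ≈P⇒≋ (*P-assoc p r s)
      ; *-identity = (λ p → ≈P⇒≋ (*P-identityˡ p)) , (λ p → ≋-trans (*-comm p (constP 1ℤ)) (≈P⇒≋ (*P-identityˡ p)))
      ; distrib = distribˡ , (λ p r s → ≋-trans (*-comm (r ++ s) p) (≋-trans (distribˡ p r s)
                                         (+P-cong (*-comm p r) (*-comm p s)))) }
    ; *-comm = *-comm } }
  where
  ≡⇒≋ : {p r : Poly} → p ≡ r → p ≋ r
  ≡⇒≋ refl = ≋-refl

  +-comm : (p r : Poly) → (p +P r) ≋ (r +P p)
  +-comm p r = ≈P⇒≋ (λ a b → trans (coeffP-++ p r a b) (trans (ℤ.+-comm (coeffP p a b) (coeffP r a b)) (sym (coeffP-++ r p a b))))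

  inverseʳ : (p : Poly) → (p +P negP p) ≋ []
  inverseʳ p = ≈P⇒≋ (λ a b → trans (coeffP-++ p (negP p) a b)
                               (trans (cong (coeffP p a b +ℤ_) (coeffP-negP p a b)) (ℤ.+-inverseʳ (coeffP p a b))))

  *-comm : (p r : Poly) → (p *P r) ≋ (r *P p)
  *-comm p r = ≈P⇒≋ (*P-comm p r)

  distribˡ : (p r s : Poly) → (p *P (r ++ s)) ≋ ((p *P r) ++ (p *P s))
  distribˡ p r s = ≈P⇒≋ (*P-distribˡ p r s)

module Poly = CommutativeRing Poly-commutativeRing
module PolySolver = RingSolver Poly.rawRing (fromCommutativeRing Poly-commutativeRing)
                      (-raw-almostCommutative⟶ (fromCommutativeRing Poly-commutativeRing)) (λ _ _ → nothing)

-- ℤ[q,t] is an integral domain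

module Lex = StrictTotalOrder (×-strictTotalOrder ℕ.<-strictTotalOrder ℕ.<-strictTotalOrder)

_<ₗ_ : ℕ × ℕ → ℕ × ℕ → Set
_<ₗ_ = Lex._<_

<ₗ-irrefl : ∀ s → ¬ s <ₗ s
<ₗ-irrefl s = Lex.irrefl (refl , refl)

<ₗ-residual : ∀ {x y x₀ y₀} x₁ y₁ → (x , y) <ₗ (x₀ , y₀) → x ≤ x₀ + x₁ → y ≤ y₀ + y₁ →
              (x₁ , y₁) <ₗ (x₀ + x₁ ∸ x , y₀ + y₁ ∸ y)
<ₗ-residual {x} x₁ y₁ (inj₁ x<x₀) x≤ _ =
  inj₁ (ℕ.+-cancelˡ-< x x₁ _ (subst (x + x₁ <_) (sym (ℕ.m+[n∸m]≡n x≤)) (ℕ.+-monoˡ-< x₁ x<x₀)))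
<ₗ-residual {x} {y} x₁ y₁ (inj₂ (refl , y<y₀)) _ y≤ =
  inj₂ (sym (ℕ.m+n∸m≡n x x₁) , ℕ.+-cancelˡ-< y y₁ _ (subst (y + y₁ <_) (sym (ℕ.m+[n∸m]≡n y≤)) (ℕ.+-monoˡ-< y₁ y<y₀)))

coeffM-self : (c : ℤ) (x y : ℕ) → coeffM x y (c , x , y) ≡ c
coeffM-self c x y rewrite dec-true (x ≟ x) refl | dec-true (y ≟ y) refl = refl

coeffM-off : (m : Monomial) {a b : ℕ} → exponent m ≢ (a , b) → coeffM a b m ≡ 0ℤ
coeffM-off (c , x , y) {a} {b} off with x ≟ a | y ≟ b
... | yes refl | yes refl = ⊥-elim (off refl)
... | no x≢a   | _        rewrite dec-false (x ≟ a) x≢a = refl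
... | yes refl | no y≢b   rewrite dec-false (y ≟ b) y≢b = cong (λ t → if t then c else 0ℤ) (∧-zeroʳ (x ≡ᵇ x))

when-coeffM : {P : ℕ × ℕ → Set} (P? : ∀ s → Dec (P s)) (m : Monomial) (a b : ℕ) →
              when (P? (exponent m)) (coeffM a b m) ≡ when (P? (a , b)) (coeffM a b m)
when-coeffM P? m a b with ≡-dec _≟_ _≟_ (exponent m) (a , b)
... | yes m≡ab rewrite m≡ab = refl
... | no m≢ab  rewrite coeffM-off m m≢ab = trans (when-0 (P? (exponent m))) (sym (when-0 (P? (a , b))))

coeffP-support : (p : Poly) {a b : ℕ} → coeffP p a b ≢ 0ℤ → (a , b) ∈ map exponent p
coeffP-support []      nz = ⊥-elim (nz refl)
coeffP-support (m ∷ p) {a} {b} nz with ≡-dec _≟_ _≟_ (exponent m) (a , b)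
... | yes m≡ab = here (sym m≡ab)
... | no m≢ab  = there (coeffP-support p (λ z → nz (cong₂ _+ℤ_ (coeffM-off m m≢ab) z)))

coeffP-vanishes-off-support : (p : Poly) {Q : ℕ × ℕ → Set} →
  All (λ s → Q s → coeffP p (proj₁ s) (proj₂ s) ≡ 0ℤ) (map exponent p) →
  ∀ a b → Q (a , b) → coeffP p a b ≡ 0ℤ
coeffP-vanishes-off-support p vanish a b q with coeffP p a b ℤ.≟ 0ℤ
... | yes z  = z
... | no nz  = All.lookup vanish (coeffP-support p nz) q

_≈P[]? : (p : Poly) → Dec (p ≈P [])
p ≈P[]? with All.all? (λ s → coeffP p (proj₁ s) (proj₂ s) ℤ.≟ 0ℤ) (map exponent p)
... | yes vanish = yes (λ a b → coeffP-vanishes-off-support p (All.map const vanish) a b tt)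
... | no ¬vanish = no (λ p≈[] → ¬vanish (All.tabulate (λ _ → p≈[] _ _)))

lexMaxNonzero : (f : ℕ × ℕ → ℤ) (ss : List (ℕ × ℕ)) →
  All (λ s → f s ≡ 0ℤ) ss ⊎ ∃ λ t → f t ≢ 0ℤ × All (λ s → t <ₗ s → f s ≡ 0ℤ) ss
lexMaxNonzero f []       = inj₁ []
lexMaxNonzero f (s ∷ ss) with lexMaxNonzero f ss | f s ℤ.≟ 0ℤ
... | inj₁ zs            | yes z  = inj₁ (z ∷ zs)
... | inj₁ zs            | no nz  = inj₂ (s , nz , (λ s<s → ⊥-elim (<ₗ-irrefl s s<s)) ∷ All.map const zs)
... | inj₂ (t , nz , zs) | yes z  = inj₂ (t , nz , const z ∷ zs)
... | inj₂ (t , nz , zs) | no nzs with t Lex.<? s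
...   | yes t<s = inj₂ (s , nzs , (λ s<s → ⊥-elim (<ₗ-irrefl s s<s)) ∷ All.map (λ z s<s′ → z (Lex.trans t<s s<s′)) zs)
...   | no t≮s  = inj₂ (t , nz , (λ t<s → ⊥-elim (t≮s t<s)) ∷ zs)

Leading : Poly → ℕ → ℕ → Set
Leading p x y = coeffP p x y ≢ 0ℤ × (∀ a b → (x , y) <ₗ (a , b) → coeffP p a b ≡ 0ℤ)

leading : (p : Poly) → ¬ p ≈P [] → ∃ λ x → ∃ λ y → Leading p x y
leading p p≉0 with lexMaxNonzero (λ s → coeffP p (proj₁ s) (proj₂ s)) (map exponent p)
... | inj₁ zs = ⊥-elim (p≉0 (λ a b → coeffP-vanishes-off-support p (All.map const zs) a b tt))
... | inj₂ ((x , y) , nz , zs) = x , y , nz , (λ a b → coeffP-vanishes-off-support p zs a b)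

-- Split the terms m of p by whether exponent m lies lexicographically above (x₀ , y₀). Those above
-- contribute 0 in total (high), though not one by one, as p may repeat or cancel monomials; of the others
-- only the exponent (x₀ , y₀) contributes (low), because r vanishes above (x₁ , y₁).
module _ (p r : Poly) {x₀ y₀ x₁ y₁ : ℕ} (lead-p : Leading p x₀ y₀) (lead-r : Leading r x₁ y₁) where

  private
    A B : ℕ
    A = x₀ + x₁
    B = y₀ + y₁

    K : ℤ
    K = coeffP r x₁ y₁

    above? : (s : ℕ × ℕ) → Dec ((x₀ , y₀) <ₗ s)
    above? s = (x₀ , y₀) Lex.<? s

    T : Monomial → ℤ
    T m = ℤ∑.∑ r (λ n → coeffM A B (m *M n))

    ∑-above : ∀ a b → ℤ∑.∑ p (λ m → when (above? (exponent m)) (coeffM a b m)) ≡ 0ℤ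
    ∑-above a b = begin
      ℤ∑.∑ p (λ m → when (above? (exponent m)) (coeffM a b m)) ≡⟨ ℤ∑.∑-cong p (λ m → when-coeffM above? m a b) ⟩
      ℤ∑.∑ p (λ m → when (above? (a , b)) (coeffM a b m))      ≡⟨ sym (when-∑ (above? (a , b)) p (coeffM a b)) ⟩
      when (above? (a , b)) (ℤ∑.∑ p (coeffM a b))              ≡⟨ cong (when (above? (a , b))) (sym (coeffP≡∑ p a b)) ⟩
      when (above? (a , b)) (coeffP p a b)                     ≡⟨ vanish (above? (a , b)) ⟩
      0ℤ                                                       ∎
      where
      open ≡-Reasoning
      vanish : (D : Dec ((x₀ , y₀) <ₗ (a , b))) → when D (coeffP p a b) ≡ 0ℤ
      vanish (yes above) = proj₂ lead-p a b above
      vanish (no _)      = refl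

    when-when-* : {P Q : Set} (D : Dec P) (E : Dec Q) (d z : ℤ) → when D (d *ℤ when E z) ≡ d *ℤ when E (when D z)
    when-when-* D (yes _) d z = when-* D d z
    when-when-* D (no _)  d z = trans (cong (when D) (ℤ.*-zeroʳ d)) (trans (when-0 D) (sym (ℤ.*-zeroʳ d)))

    high : ℤ∑.∑ p (λ m → when (above? (exponent m)) (T m)) ≡ 0ℤ
    high = begin
      ℤ∑.∑ p (λ m → when (D m) (T m))
        ≡⟨ ℤ∑.∑-cong p (λ m → when-∑ (D m) r _) ⟩
      ℤ∑.∑ p (λ m → ℤ∑.∑ r (λ n → when (D m) (coeffM A B (m *M n))))
        ≡⟨ ℤ∑.∑-comm p r _ ⟩
      ℤ∑.∑ r (λ n → ℤ∑.∑ p (λ m → when (D m) (coeffM A B (m *M n))))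
        ≡⟨ ℤ∑.∑-zero r high-n ⟩
      0ℤ ∎
      where
      open ≡-Reasoning
      D : (m : Monomial) → Dec ((x₀ , y₀) <ₗ exponent m)
      D m = above? (exponent m)
      high-n : ∀ n → ℤ∑.∑ p (λ m → when (D m) (coeffM A B (m *M n))) ≡ 0ℤ
      high-n (d , u , v) = begin
        ℤ∑.∑ p (λ m → when (D m) (coeffM A B (m *M (d , u , v))))
          ≡⟨ ℤ∑.∑-cong p (λ m → cong (when (D m)) (trans (coeffM-*M-comm m (d , u , v) A B) (coeffM-*M d u v A B m))) ⟩
        ℤ∑.∑ p (λ m → when (D m) (d *ℤ when E (coeffM (A ∸ u) (B ∸ v) m)))
          ≡⟨ ℤ∑.∑-cong p (λ m → when-when-* (D m) E d _) ⟩
        ℤ∑.∑ p (λ m → d *ℤ when E (when (D m) (coeffM (A ∸ u) (B ∸ v) m)))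
          ≡⟨ sym (ℤ∑.*-∑ d p _) ⟩
        d *ℤ ℤ∑.∑ p (λ m → when E (when (D m) (coeffM (A ∸ u) (B ∸ v) m)))
          ≡⟨ cong (d *ℤ_) (sym (when-∑ E p _)) ⟩
        d *ℤ when E (ℤ∑.∑ p (λ m → when (D m) (coeffM (A ∸ u) (B ∸ v) m)))
          ≡⟨ cong (λ z → d *ℤ when E z) (∑-above (A ∸ u) (B ∸ v)) ⟩
        d *ℤ when E 0ℤ
          ≡⟨ trans (cong (d *ℤ_) (when-0 E)) (ℤ.*-zeroʳ d) ⟩
        0ℤ ∎
        where
        E : Dec (u ≤ A × v ≤ B)
        E = below? u v A B

    low : ∀ m → unless (above? (exponent m)) (T m) ≡ coeffM x₀ y₀ m *ℤ K
    low (c , x , y) with above? (x , y)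
    ... | yes above = sym (trans (cong (_*ℤ K) (coeffM-off (c , x , y) (λ { refl → <ₗ-irrefl _ above }))) (ℤ.*-zeroˡ K))
    ... | no ¬above with Lex.compare (x , y) (x₀ , y₀)
    ...   | tri> _ _ above            = ⊥-elim (¬above above)
    ...   | tri≈ _ (refl , refl) _    = trans (∑-coeffM-*M c x y r A B) (cong₂ _*ℤ_ (sym (coeffM-self c x y)) at-top)
      where
      at-top : when (below? x y A B) (coeffP r (A ∸ x) (B ∸ y)) ≡ K
      at-top with below? x y A B
      ... | yes _ = cong₂ (coeffP r) (ℕ.m+n∸m≡n x x₁) (ℕ.m+n∸m≡n y y₁)
      ... | no ¬below = ⊥-elim (¬below (ℕ.m≤m+n x x₁ , ℕ.m≤m+n y y₁))
    ...   | tri< below-top _ _ = begin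
      T (c , x , y)                                                  ≡⟨ ∑-coeffM-*M c x y r A B ⟩
      c *ℤ when (below? x y A B) (coeffP r (A ∸ x) (B ∸ y))          ≡⟨ cong (c *ℤ_) beyond-r ⟩
      c *ℤ 0ℤ                                                        ≡⟨ ℤ.*-zeroʳ c ⟩
      0ℤ                                                             ≡⟨ sym (ℤ.*-zeroˡ K) ⟩
      0ℤ *ℤ K
        ≡⟨ cong (_*ℤ K) (sym (coeffM-off (c , x , y) (λ { refl → <ₗ-irrefl _ below-top }))) ⟩
      coeffM x₀ y₀ (c , x , y) *ℤ K                                  ∎
      where
      open ≡-Reasoning
      beyond-r : when (below? x y A B) (coeffP r (A ∸ x) (B ∸ y)) ≡ 0ℤ
      beyond-r with below? x y A B
      ... | yes (x≤A , y≤B) = proj₂ lead-r _ _ (<ₗ-residual x₁ y₁ below-top x≤A y≤B)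
      ... | no _            = refl

  coeffP-*P-leading : coeffP (p *P r) (x₀ + x₁) (y₀ + y₁) ≡ coeffP p x₀ y₀ *ℤ coeffP r x₁ y₁
  coeffP-*P-leading = begin
    coeffP (p *P r) A B                                             ≡⟨ coeffP-*P p r A B ⟩
    ℤ∑.∑ p T                                                        ≡⟨ ℤ∑.∑-cong p (λ m → when+unless (D m) (T m)) ⟩
    ℤ∑.∑ p (λ m → when (D m) (T m) +ℤ unless (D m) (T m))           ≡⟨ ℤ∑.∑-+ p _ _ ⟩
    ℤ∑.∑ p (λ m → when (D m) (T m)) +ℤ ℤ∑.∑ p (λ m → unless (D m) (T m))
      ≡⟨ cong₂ _+ℤ_ high (ℤ∑.∑-cong p low) ⟩
    0ℤ +ℤ ℤ∑.∑ p (λ m → coeffM x₀ y₀ m *ℤ K)                         ≡⟨ ℤ.+-identityˡ _ ⟩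
    ℤ∑.∑ p (λ m → coeffM x₀ y₀ m *ℤ K)                              ≡⟨ ℤ∑.∑-cong p (λ m → ℤ.*-comm (coeffM x₀ y₀ m) K) ⟩
    ℤ∑.∑ p (λ m → K *ℤ coeffM x₀ y₀ m)                              ≡⟨ sym (ℤ∑.*-∑ K p _) ⟩
    K *ℤ ℤ∑.∑ p (coeffM x₀ y₀)                                      ≡⟨ cong (K *ℤ_) (sym (coeffP≡∑ p x₀ y₀)) ⟩
    K *ℤ coeffP p x₀ y₀                                             ≡⟨ ℤ.*-comm K _ ⟩
    coeffP p x₀ y₀ *ℤ K                                             ∎
    where
    open ≡-Reasoning
    D : (m : Monomial) → Dec ((x₀ , y₀) <ₗ exponent m)
    D m = above? (exponent m)

*P-nonzero : {p r : Poly} → ¬ p ≈P [] → ¬ r ≈P [] → ¬ (p *P r) ≈P []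
*P-nonzero {p} {r} p≉0 r≉0 pr≈0 with leading p p≉0 | leading r r≉0
... | x₀ , y₀ , lead-p | x₁ , y₁ , lead-r
  with ℤ.i*j≡0⇒i≡0∨j≡0 (coeffP p x₀ y₀) (trans (sym (coeffP-*P-leading p r lead-p lead-r)) (pr≈0 _ _))
...   | inj₁ z = proj₁ lead-p z
...   | inj₂ z = proj₁ lead-r z

*P-cancelˡ-≈P[] : {d w : Poly} → ¬ d ≈P [] → (d *P w) ≈P [] → w ≈P []
*P-cancelˡ-≈P[] {d} {w} d≉0 dw≈0 with w ≈P[]?
... | yes w≈0 = w≈0
... | no w≉0  = ⊥-elim (*P-nonzero {d} {w} d≉0 w≉0 dw≈0)

-- The field of fractions ℚ(q,t)

open PolySolver using (solve; _:=_; _:+_; _:*_; :-_; con)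
open import Algebra.Properties.Group Poly.+-group using (x∙y⁻¹≈ε⇒x≈y)

constP-suc≉0 : (k : ℕ) → ¬ constP (+ suc k) ≈P []
constP-suc≉0 k c≈0 with c≈0 0 0
... | ()

negF : Frac → Frac
negF (a / b) = negP a / b

valid-+F : {x y : Frac} → ValidF x → ValidF y → ValidF (x +F y)
valid-+F {x} {y} = *P-nonzero {den x} {den y}

valid-*F : {x y : Frac} → ValidF x → ValidF y → ValidF (x *F y)
valid-*F {x} {y} = *P-nonzero {den x} {den y}

valid-1F : ValidF 1F
valid-1F = constP-suc≉0 0

≈F-refl : (x : Frac) → x ≈F x
≈F-refl x _ _ = refl

≈F-sym : (x y : Frac) → x ≈F y → y ≈F x
≈F-sym x y x≈y a b = sym (x≈y a b)

≈F⇒≋ : (x y : Frac) → x ≈F y → (num x *P den y) ≋ (num y *P den x)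
≈F⇒≋ x y = ≈P⇒≋

-- Cross-multiplying gives d (a f - e b) = 0, and d ≠ 0 cancels in ℤ[q,t].
≈F-trans : (x y z : Frac) → ValidF y → x ≈F y → y ≈F z → x ≈F z
≈F-trans (a / b) (c / d) (e / f) d≉0 ad≈cb cf≈ed = ≋⇒≈P (x∙y⁻¹≈ε⇒x≈y (a *P f) (e *P b) (≈P⇒≋ w≈0))
  where
  open SetoidReasoning Poly.setoid
  w : Poly
  w = (a *P f) ++ negP (e *P b)
  ad≋cb : (a *P d) ≋ (c *P b)
  ad≋cb = ≈F⇒≋ (a / b) (c / d) ad≈cb
  cf≋ed : (c *P f) ≋ (e *P d)
  cf≋ed = ≈F⇒≋ (c / d) (e / f) cf≈ed
  dw≈0 : (d *P w) ≋ []
  dw≈0 = begin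
    d *P w
      ≈⟨ solve 6 (λ a b c d e f → d :* ((a :* f) :+ (:- (e :* b))) := ((a :* d) :* f) :+ (:- (b :* (e :* d)))) Poly.refl a b c d e f ⟩
    ((a *P d) *P f) ++ negP (b *P (e *P d))
      ≈⟨ Poly.+-cong (Poly.*-cong ad≋cb (Poly.refl {f})) (Poly.-‿cong (Poly.*-cong (Poly.refl {b}) (Poly.sym cf≋ed))) ⟩
    ((c *P b) *P f) ++ negP (b *P (c *P f))
      ≈⟨ Poly.+-cong (Poly.refl {(c *P b) *P f}) (Poly.-‿cong (solve 3 (λ b c f → b :* (c :* f) := (c :* b) :* f) Poly.refl b c f)) ⟩
    ((c *P b) *P f) ++ negP ((c *P b) *P f)
      ≈⟨ Poly.-‿inverseʳ ((c *P b) *P f) ⟩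
    [] ∎
  w≈0 : w ≈P []
  w≈0 = *P-cancelˡ-≈P[] {d} {w} d≉0 (≋⇒≈P dw≈0)

+F-cong : (x x′ y y′ : Frac) → x ≈F x′ → y ≈F y′ → (x +F y) ≈F (x′ +F y′)
+F-cong (a / b) (a′ / b′) (c / d) (c′ / d′) x≈x′ y≈y′ = ≋⇒≈P $ begin
  ((a *P d) ++ (c *P b)) *P (b′ *P d′)
    ≈⟨ solve 6 (λ a b c d b′ d′ → ((a :* d) :+ (c :* b)) :* (b′ :* d′)
                                 := ((a :* b′) :* (d :* d′)) :+ ((c :* d′) :* (b :* b′)))
             Poly.refl a b c d b′ d′ ⟩
  ((a *P b′) *P (d *P d′)) ++ ((c *P d′) *P (b *P b′))
    ≈⟨ Poly.+-cong (Poly.*-cong (≈F⇒≋ (a / b) (a′ / b′) x≈x′) (Poly.refl {d *P d′}))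
                   (Poly.*-cong (≈F⇒≋ (c / d) (c′ / d′) y≈y′) (Poly.refl {b *P b′})) ⟩
  ((a′ *P b) *P (d *P d′)) ++ ((c′ *P d) *P (b *P b′))
    ≈⟨ solve 6 (λ a′ b c′ d b′ d′ → ((a′ :* b) :* (d :* d′)) :+ ((c′ :* d) :* (b :* b′))
                                   := ((a′ :* d′) :+ (c′ :* b′)) :* (b :* d))
             Poly.refl a′ b c′ d b′ d′ ⟩
  ((a′ *P d′) ++ (c′ *P b′)) *P (b *P d) ∎
  where open SetoidReasoning Poly.setoid

*F-cong : (x x′ y y′ : Frac) → x ≈F x′ → y ≈F y′ → (x *F y) ≈F (x′ *F y′)
*F-cong (a / b) (a′ / b′) (c / d) (c′ / d′) x≈x′ y≈y′ = ≋⇒≈P $ begin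
  (a *P c) *P (b′ *P d′)   ≈⟨ solve 4 (λ a c b′ d′ → (a :* c) :* (b′ :* d′) := (a :* b′) :* (c :* d′)) Poly.refl a c b′ d′ ⟩
  (a *P b′) *P (c *P d′)   ≈⟨ Poly.*-cong (≈F⇒≋ (a / b) (a′ / b′) x≈x′) (≈F⇒≋ (c / d) (c′ / d′) y≈y′) ⟩
  (a′ *P b) *P (c′ *P d)   ≈⟨ solve 4 (λ a′ b c′ d → (a′ :* b) :* (c′ :* d) := (a′ :* c′) :* (b :* d)) Poly.refl a′ b c′ d ⟩
  (a′ *P c′) *P (b *P d)   ∎
  where open SetoidReasoning Poly.setoid

negF-cong : (x x′ : Frac) → x ≈F x′ → negF x ≈F negF x′
negF-cong (a / b) (a′ / b′) x≈x′ = ≋⇒≈P $ begin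
  negP a *P b′     ≈⟨ solve 2 (λ a b′ → (:- a) :* b′ := :- (a :* b′)) Poly.refl a b′ ⟩
  negP (a *P b′)   ≈⟨ Poly.-‿cong (≈F⇒≋ (a / b) (a′ / b′) x≈x′) ⟩
  negP (a′ *P b)   ≈⟨ solve 2 (λ a′ b → :- (a′ :* b) := (:- a′) :* b) Poly.refl a′ b ⟩
  negP a′ *P b     ∎
  where open SetoidReasoning Poly.setoid

+F-assoc : (x y z : Frac) → ((x +F y) +F z) ≈F (x +F (y +F z))
+F-assoc (a / b) (c / d) (e / f) = ≋⇒≈P $ solve 6
  (λ a b c d e f → (((a :* d :+ c :* b) :* f) :+ (e :* (b :* d))) :* (b :* (d :* f))
                := ((a :* (d :* f)) :+ (((c :* f) :+ (e :* d)) :* b)) :* ((b :* d) :* f))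
  Poly.refl a b c d e f

+F-comm : (x y : Frac) → (x +F y) ≈F (y +F x)
+F-comm (a / b) (c / d) = ≋⇒≈P $ solve 4
  (λ a b c d → ((a :* d) :+ (c :* b)) :* (d :* b) := ((c :* b) :+ (a :* d)) :* (b :* d)) Poly.refl a b c d

+F-identityˡ : (x : Frac) → (0F +F x) ≈F x
+F-identityˡ (a / b) = ≋⇒≈P $ solve 2
  (λ a b → ((con [] :* b) :+ (a :* con (constP 1ℤ))) :* b := a :* (con (constP 1ℤ) :* b)) Poly.refl a b

+F-inverseʳ : (x : Frac) → (x +F negF x) ≈F 0F
+F-inverseʳ (a / b) = ≋⇒≈P $ begin
  ((a *P b) ++ (negP a *P b)) *P constP 1ℤ ≈⟨ Poly.*-identityʳ _ ⟩
  (a *P b) ++ (negP a *P b)                ≈⟨ Poly.sym (Poly.distribʳ b a (negP a)) ⟩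
  (a ++ negP a) *P b                       ≈⟨ Poly.*-cong (Poly.-‿inverseʳ a) (Poly.refl {b}) ⟩
  [] *P b                                  ≈⟨ Poly.zeroˡ b ⟩
  []                                       ≈⟨ Poly.sym (Poly.zeroˡ (b *P b)) ⟩
  [] *P (b *P b)                           ∎
  where open SetoidReasoning Poly.setoid

*F-assoc : (x y z : Frac) → ((x *F y) *F z) ≈F (x *F (y *F z))
*F-assoc (a / b) (c / d) (e / f) = ≋⇒≈P $ solve 6
  (λ a b c d e f → ((a :* c) :* e) :* (b :* (d :* f)) := (a :* (c :* e)) :* ((b :* d) :* f)) Poly.refl a b c d e f

*F-comm : (x y : Frac) → (x *F y) ≈F (y *F x)
*F-comm (a / b) (c / d) = ≋⇒≈P $ solve 4
  (λ a b c d → (a :* c) :* (d :* b) := (c :* a) :* (b :* d)) Poly.refl a b c d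

*F-identityˡ : (x : Frac) → (1F *F x) ≈F x
*F-identityˡ (a / b) = ≋⇒≈P $ solve 2
  (λ a b → (con (constP 1ℤ) :* a) :* b := a :* (con (constP 1ℤ) :* b)) Poly.refl a b

*F-distribʳ : (x y z : Frac) → ((y +F z) *F x) ≈F ((y *F x) +F (z *F x))
*F-distribʳ (a / b) (c / d) (e / f) = ≋⇒≈P $ solve 6
  (λ a b c d e f → (((c :* f) :+ (e :* d)) :* a) :* ((d :* b) :* (f :* b))
                := (((c :* a) :* (f :* b)) :+ ((e :* a) :* (d :* b))) :* ((d :* f) :* b))
  Poly.refl a b c d e f

ValidFrac : Set
ValidFrac = Σ Frac ValidF

record _≈V_ (x y : ValidFrac) : Set where
  constructor ≈F⇒≈V
  field ≈V⇒≈F : proj₁ x ≈F proj₁ y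
open _≈V_ public

infix 4 _≈V_

-- Opaque to keep typechecking fast: only the next block looks inside these definitions.
opaque
  _+V_ : ValidFrac → ValidFrac → ValidFrac
  (x , x-valid) +V (y , y-valid) = x +F y , valid-+F {x} {y} x-valid y-valid

  _*V_ : ValidFrac → ValidFrac → ValidFrac
  (x , x-valid) *V (y , y-valid) = x *F y , valid-*F {x} {y} x-valid y-valid

  -V_ : ValidFrac → ValidFrac
  -V (x , x-valid) = negF x , x-valid

  0V 1V : ValidFrac
  0V = 0F , valid-1F
  1V = 1F , valid-1F

  -- A fraction with zero denominator, which is not an element of ℚ(q,t), is sent to 0.
  toV : Frac → ValidFrac
  toV x with den x ≈P[]?
  ... | yes _       = 0V
  ... | no  x-valid = x , x-valid

infixl 6 _+V_
infixl 7 _*V_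

opaque
  unfolding _+V_ _*V_ -V_ 0V toV

  proj₁-+V : (x y : ValidFrac) → proj₁ (x +V y) ≡ proj₁ x +F proj₁ y
  proj₁-+V x y = refl

  proj₁-0V : proj₁ 0V ≡ 0F
  proj₁-0V = refl

  proj₁-toV : (x : Frac) → ValidF x → proj₁ (toV x) ≡ x
  proj₁-toV x x-valid with den x ≈P[]?
  ... | yes x-invalid = ⊥-elim (x-valid x-invalid)
  ... | no  _         = refl

  toV-*F : (x y : Frac) → ValidF x → ValidF y → toV (x *F y) ≈V toV x *V toV y
  toV-*F x y x-valid y-valid with den x ≈P[]? | den y ≈P[]? | den (x *F y) ≈P[]?
  ... | yes x-invalid | _             | _              = ⊥-elim (x-valid x-invalid)
  ... | no _          | yes y-invalid | _              = ⊥-elim (y-valid y-invalid)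
  ... | no _          | no _          | yes xy-invalid = ⊥-elim (valid-*F {x} {y} x-valid y-valid xy-invalid)
  ... | no _          | no _          | no _           = ≈F⇒≈V (≈F-refl (x *F y))

  toV-1F : toV 1F ≈V 1V
  toV-1F with den 1F ≈P[]?
  ... | yes 1-invalid = ⊥-elim (valid-1F 1-invalid)
  ... | no _          = ≈F⇒≈V (≈F-refl 1F)

  toV-zero : (x : Frac) → num x ≈P [] → toV x ≈V 0V
  toV-zero x x≈0 with den x ≈P[]?
  ... | yes _ = ≈F⇒≈V (≈F-refl 0F)
  ... | no  _ = ≈F⇒≈V (≋⇒≈P (Poly.trans (Poly.*-cong (≈P⇒≋ {num x} {[]} x≈0) (Poly.refl {constP 1ℤ}))
                                         (Poly.trans (Poly.zeroˡ (constP 1ℤ)) (Poly.sym (Poly.zeroˡ (den x))))))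

  ≈V-refl : (x : ValidFrac) → x ≈V x
  ≈V-refl x = ≈F⇒≈V (≈F-refl (proj₁ x))

  ≈V-sym : {x y : ValidFrac} → x ≈V y → y ≈V x
  ≈V-sym {x} {y} (≈F⇒≈V x≈y) = ≈F⇒≈V (≈F-sym (proj₁ x) (proj₁ y) x≈y)

  ≈V-trans : {x y z : ValidFrac} → x ≈V y → y ≈V z → x ≈V z
  ≈V-trans {x} {y} {z} (≈F⇒≈V x≈y) (≈F⇒≈V y≈z) =
    ≈F⇒≈V (≈F-trans (proj₁ x) (proj₁ y) (proj₁ z) (proj₂ y) x≈y y≈z)

  +V-cong : {x x′ y y′ : ValidFrac} → x ≈V x′ → y ≈V y′ → x +V y ≈V x′ +V y′
  +V-cong {x} {x′} {y} {y′} (≈F⇒≈V x≈x′) (≈F⇒≈V y≈y′) =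
    ≈F⇒≈V (+F-cong (proj₁ x) (proj₁ x′) (proj₁ y) (proj₁ y′) x≈x′ y≈y′)

  -V-cong : {x y : ValidFrac} → x ≈V y → -V x ≈V -V y
  -V-cong {x} {y} (≈F⇒≈V x≈y) = ≈F⇒≈V (negF-cong (proj₁ x) (proj₁ y) x≈y)

  *V-cong : {x x′ y y′ : ValidFrac} → x ≈V x′ → y ≈V y′ → x *V y ≈V x′ *V y′
  *V-cong {x} {x′} {y} {y′} (≈F⇒≈V x≈x′) (≈F⇒≈V y≈y′) =
    ≈F⇒≈V (*F-cong (proj₁ x) (proj₁ x′) (proj₁ y) (proj₁ y′) x≈x′ y≈y′)

  +V-assoc : (x y z : ValidFrac) → (x +V y) +V z ≈V x +V (y +V z)
  +V-assoc x y z = ≈F⇒≈V (+F-assoc (proj₁ x) (proj₁ y) (proj₁ z))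

  +V-comm : (x y : ValidFrac) → x +V y ≈V y +V x
  +V-comm x y = ≈F⇒≈V (+F-comm (proj₁ x) (proj₁ y))

  +V-identityˡ : (x : ValidFrac) → 0V +V x ≈V x
  +V-identityˡ x = ≈F⇒≈V (+F-identityˡ (proj₁ x))

  +V-inverseʳ : (x : ValidFrac) → x +V -V x ≈V 0V
  +V-inverseʳ x = ≈F⇒≈V (+F-inverseʳ (proj₁ x))

  *V-assoc : (x y z : ValidFrac) → (x *V y) *V z ≈V x *V (y *V z)
  *V-assoc x y z = ≈F⇒≈V (*F-assoc (proj₁ x) (proj₁ y) (proj₁ z))

  *V-comm : (x y : ValidFrac) → x *V y ≈V y *V x
  *V-comm x y = ≈F⇒≈V (*F-comm (proj₁ x) (proj₁ y))

  *V-identityˡ : (x : ValidFrac) → 1V *V x ≈V x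
  *V-identityˡ x = ≈F⇒≈V (*F-identityˡ (proj₁ x))

  *V-distribʳ : (x y z : ValidFrac) → (y +V z) *V x ≈V y *V x +V z *V x
  *V-distribʳ x y z = ≈F⇒≈V (*F-distribʳ (proj₁ x) (proj₁ y) (proj₁ z))

ValidFrac-commutativeRing : CommutativeRing 0ℓ 0ℓ
ValidFrac-commutativeRing = record
  { Carrier = ValidFrac ; _≈_ = _≈V_ ; _+_ = _+V_ ; _*_ = _*V_ ; -_ = -V_ ; 0# = 0V ; 1# = 1V
  ; isCommutativeRing = record
    { isRing = record
      { +-isAbelianGroup = record
        { isGroup = record
          { isMonoid = record
            { isSemigroup = record
              { isMagma = record
                { isEquivalence = record { refl = λ {x} → ≈V-refl x ; sym = ≈V-sym ; trans = ≈V-trans }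
                ; ∙-cong = +V-cong }
              ; assoc = +V-assoc }
            ; identity = +V-identityˡ , (λ x → ≈V-trans (+V-comm x 0V) (+V-identityˡ x)) }
          ; inverse = (λ x → ≈V-trans (+V-comm (-V x) x) (+V-inverseʳ x)) , +V-inverseʳ
          ; ⁻¹-cong = -V-cong }
        ; comm = +V-comm }
      ; *-cong = *V-cong
      ; *-assoc = *V-assoc
      ; *-identity = *V-identityˡ , (λ x → ≈V-trans (*V-comm x 1V) (*V-identityˡ x))
      ; distrib = (λ x y z → ≈V-trans (*V-comm x (y +V z)) (≈V-trans (*V-distribʳ x y z) (+V-cong (*V-comm y x) (*V-comm z x))))
                , *V-distribʳ }
    ; *-comm = *V-comm } }

module V = CommutativeRing ValidFrac-commutativeRing
module V∑ = ListSum ValidFrac-commutativeRing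
open CommutativeSemigroupProperties V.+-commutativeSemigroup using () renaming (x∙yz≈y∙xz to +-x∙yz≈y∙xz)
open CommutativeSemigroupProperties V.*-commutativeSemigroup using () renaming (x∙yz≈y∙xz to *-x∙yz≈y∙xz)

-- Coefficients of symmetric functions and linear functionals on them

_≟ₗ_ : (σ ρ : List ℕ) → Dec (σ ≡ ρ)
_≟ₗ_ = List.≡-dec _≟_

eqListᵇ≡does : (σ ρ : List ℕ) → eqListᵇ σ ρ ≡ does (σ ≟ₗ ρ)
eqListᵇ≡does []      []      = refl
eqListᵇ≡does []      (_ ∷ _) = refl
eqListᵇ≡does (_ ∷ _) []      = refl
eqListᵇ≡does (x ∷ σ) (y ∷ ρ) = cong ((x ≡ᵇ y) ∧_) (eqListᵇ≡does σ ρ)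

term : Frac × List ℕ → List ℕ → ValidFrac
term (c , σ) ρ = if does (σ ≟ₗ ρ) then toV c else 0V

coeffV : Sym → List ℕ → ValidFrac
coeffV f ρ = V∑.∑ f (λ t → term t ρ)

_≈C_ : Sym → Sym → Set
f ≈C g = ∀ ρ → coeffV f ρ ≈V coeffV g ρ

infix 4 _≈C_

≈C-trans : {f g h : Sym} → f ≈C g → g ≈C h → f ≈C h
≈C-trans f≈g g≈h ρ = V.trans (f≈g ρ) (g≈h ρ)

coeffS≡coeffV : (f : Sym) → ValidS f → ∀ ρ → coeffS f ρ ≡ proj₁ (coeffV f ρ)
coeffS≡coeffV []            []                ρ = sym proj₁-0V
coeffS≡coeffV ((c , σ) ∷ f) (c-valid ∷ f-valid) ρ
  rewrite coeffS≡coeffV f f-valid ρ | proj₁-+V (term (c , σ) ρ) (coeffV f ρ) | eqListᵇ≡does σ ρ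
  with does (σ ≟ₗ ρ)
... | true  = cong (_+F proj₁ (coeffV f ρ)) (sym (proj₁-toV c c-valid))
... | false = cong (_+F proj₁ (coeffV f ρ)) (sym proj₁-0V)

≈S⇒≈C : {f g : Sym} → ValidS f → ValidS g → f ≈S g → f ≈C g
≈S⇒≈C {f} {g} f-valid g-valid f≈g ρ =
  ≈F⇒≈V (subst₂ _≈F_ (coeffS≡coeffV f f-valid ρ) (coeffS≡coeffV g g-valid ρ) (f≈g ρ))

≈C⇒≈S : {f g : Sym} → ValidS f → ValidS g → f ≈C g → f ≈S g
≈C⇒≈S {f} {g} f-valid g-valid f≈g ρ =
  subst₂ _≈F_ (sym (coeffS≡coeffV f f-valid ρ)) (sym (coeffS≡coeffV g g-valid ρ)) (≈V⇒≈F (f≈g ρ))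

Weight : Set
Weight = List ℕ → ValidFrac

pairing : Weight → Sym → ValidFrac
pairing w f = V∑.∑ f (λ (c , σ) → toV c *V w σ)

δ : List ℕ → Weight
δ ρ σ = if does (σ ≟ₗ ρ) then 1V else 0V

coeffV≈pairing-δ : (f : Sym) (ρ : List ℕ) → coeffV f ρ ≈V pairing (δ ρ) f
coeffV≈pairing-δ f ρ = V∑.∑-cong f term≈
  where
  term≈ : ∀ t → term t ρ ≈V toV (proj₁ t) *V δ ρ (proj₂ t)
  term≈ (c , σ) with does (σ ≟ₗ ρ)
  ... | true  = V.sym (V.*-identityʳ (toV c))
  ... | false = V.sym (V.zeroʳ (toV c))

pairing-cong : (f : Sym) {w w′ : Weight} → (∀ σ → w σ ≈V w′ σ) → pairing w f ≈V pairing w′ f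
pairing-cong f w≈w′ = V∑.∑-cong f (λ (c , σ) → V.*-cong V.refl (w≈w′ σ))

pairing-congᴬ : (f : Sym) {w w′ : Weight} → All (λ (_ , σ) → w σ ≈V w′ σ) f → pairing w f ≈V pairing w′ f
pairing-congᴬ f w≈w′ = V∑.∑-congᴬ w≈w′ (λ (c , σ) e → V.*-cong V.refl e)

pairing-++ : (w : Weight) (f g : Sym) → pairing w (f ++ g) ≈V pairing w f +V pairing w g
pairing-++ w f g = V∑.∑-++ f g _

valid-scaleS : (a : Frac) → ValidF a → {h : Sym} → ValidS h → ValidS (scaleS a h)
valid-scaleS a a-valid = All.map⁺ ∘ All.map (λ {(d , _)} d-valid → valid-*F {a} {d} a-valid d-valid)

pairing-scaleS : (w : Weight) (a : Frac) → ValidF a → {h : Sym} → ValidS h → pairing w (scaleS a h) ≈V toV a *V pairing w h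
pairing-scaleS w a a-valid {[]}          []                  = V.sym (V.zeroʳ (toV a))
pairing-scaleS w a a-valid {(d , σ) ∷ h} (d-valid ∷ h-valid) = begin
  toV (a *F d) *V w σ +V pairing w (scaleS a h)
    ≈⟨ V.+-cong (V.*-cong (toV-*F a d a-valid d-valid) V.refl) (pairing-scaleS w a a-valid h-valid) ⟩
  (toV a *V toV d) *V w σ +V toV a *V pairing w h ≈⟨ V.+-cong (V.*-assoc (toV a) (toV d) (w σ)) V.refl ⟩
  toV a *V (toV d *V w σ) +V toV a *V pairing w h ≈⟨ V.sym (V.distribˡ (toV a) (toV d *V w σ) (pairing w h)) ⟩
  toV a *V (toV d *V w σ +V pairing w h)          ∎
  where open SetoidReasoning V.setoid

bindS : (List ℕ → Sym) → Sym → Sym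
bindS t f = concatMap (λ (c , σ) → scaleS c (t σ)) f

valid-bindS : {t : List ℕ → Sym} → (∀ σ → ValidS (t σ)) → {f : Sym} → ValidS f → ValidS (bindS t f)
valid-bindS t-valid {[]}          []                  = []
valid-bindS t-valid {(c , σ) ∷ f} (c-valid ∷ f-valid) = All.++⁺ (valid-scaleS c c-valid (t-valid σ)) (valid-bindS t-valid f-valid)

pairing-bindS : (w : Weight) {t : List ℕ → Sym} → (∀ σ → ValidS (t σ)) → {f : Sym} → ValidS f →
                pairing w (bindS t f) ≈V pairing (λ σ → pairing w (t σ)) f
pairing-bindS w {t} t-valid {[]}          []                  = V.refl
pairing-bindS w {t} t-valid {(c , σ) ∷ f} (c-valid ∷ f-valid) =
  V.trans (pairing-++ w (scaleS c (t σ)) (bindS t f))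
          (V.+-cong (pairing-scaleS w c c-valid (t-valid σ)) (pairing-bindS w t-valid f-valid))

coeffV-bindS : {t : List ℕ → Sym} → (∀ σ → ValidS (t σ)) → {f : Sym} → ValidS f → (ρ : List ℕ) →
               coeffV (bindS t f) ρ ≈V pairing (λ σ → coeffV (t σ) ρ) f
coeffV-bindS {t} t-valid {f} f-valid ρ = begin
  coeffV (bindS t f) ρ                       ≈⟨ coeffV≈pairing-δ (bindS t f) ρ ⟩
  pairing (δ ρ) (bindS t f)                  ≈⟨ pairing-bindS (δ ρ) t-valid f-valid ⟩
  pairing (λ σ → pairing (δ ρ) (t σ)) f      ≈⟨ pairing-cong f (λ σ → V.sym (coeffV≈pairing-δ (t σ) ρ)) ⟩
  pairing (λ σ → coeffV (t σ) ρ) f           ∎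
  where open SetoidReasoning V.setoid

dropKey : List ℕ → Sym → Sym
dropKey τ []            = []
dropKey τ ((c , σ) ∷ f) = if does (σ ≟ₗ τ) then dropKey τ f else (c , σ) ∷ dropKey τ f

dropKey-head : (τ : List ℕ) (c : Frac) (f : Sym) → dropKey τ ((c , τ) ∷ f) ≡ dropKey τ f
dropKey-head τ c f rewrite dec-true (τ ≟ₗ τ) refl = refl

length-dropKey : (τ : List ℕ) (f : Sym) → length (dropKey τ f) ≤ length f
length-dropKey τ []            = z≤n
length-dropKey τ ((c , σ) ∷ f) with does (σ ≟ₗ τ)
... | true  = ℕ.m≤n⇒m≤1+n (length-dropKey τ f)
... | false = s≤s (length-dropKey τ f)

term-other : (c : Frac) {σ ρ : List ℕ} → σ ≢ ρ → term (c , σ) ρ ≡ 0V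
term-other c {σ} {ρ} σ≢ρ rewrite dec-false (σ ≟ₗ ρ) σ≢ρ = refl

pairing-dropKey : (w : Weight) (τ : List ℕ) (f : Sym) → pairing w f ≈V coeffV f τ *V w τ +V pairing w (dropKey τ f)
pairing-dropKey w τ []            = V.sym (V.trans (V.+-identityʳ (0V *V w τ)) (V.zeroˡ (w τ)))
pairing-dropKey w τ ((c , σ) ∷ f) with σ ≟ₗ τ
... | yes refl = V.trans (V.+-cong V.refl (pairing-dropKey w τ f)) (V.trans
                   (V.sym (V.+-assoc (toV c *V w τ) (coeffV f τ *V w τ) (pairing w (dropKey τ f))))
                   (V.+-cong (V.sym (V.distribʳ (w τ) (toV c) (coeffV f τ))) V.refl))
... | no _     = V.trans (V.+-cong V.refl (pairing-dropKey w τ f)) (V.trans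
                   (+-x∙yz≈y∙xz (toV c *V w σ) (coeffV f τ *V w τ) (pairing w (dropKey τ f)))
                   (V.+-cong (V.*-cong (V.sym (V.+-identityˡ (coeffV f τ))) V.refl) V.refl))

coeffV-dropKey-self : (τ : List ℕ) (f : Sym) → coeffV (dropKey τ f) τ ≈V 0V
coeffV-dropKey-self τ []            = V.refl
coeffV-dropKey-self τ ((c , σ) ∷ f) with σ ≟ₗ τ
... | yes _ = coeffV-dropKey-self τ f
... | no σ≢τ = V.trans (V.+-cong (V.reflexive (term-other c σ≢τ)) (coeffV-dropKey-self τ f)) (V.+-identityˡ 0V)

coeffV-dropKey-other : {ρ τ : List ℕ} → ρ ≢ τ → (f : Sym) → coeffV (dropKey τ f) ρ ≈V coeffV f ρ
coeffV-dropKey-other         ρ≢τ []            = V.refl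
coeffV-dropKey-other {ρ} {τ} ρ≢τ ((c , σ) ∷ f) with σ ≟ₗ τ
... | no _     = V.+-cong V.refl (coeffV-dropKey-other ρ≢τ f)
... | yes refl with σ ≟ₗ ρ
...   | yes σ≡ρ = ⊥-elim (ρ≢τ (sym σ≡ρ))
...   | no _    = V.trans (coeffV-dropKey-other ρ≢τ f) (V.sym (V.+-identityˡ (coeffV f ρ)))

dropKey-≈C : (τ : List ℕ) (f g : Sym) → f ≈C g → dropKey τ f ≈C dropKey τ g
dropKey-≈C τ f g f≈g ρ with ρ ≟ₗ τ
... | yes refl = V.trans (coeffV-dropKey-self τ f) (V.sym (coeffV-dropKey-self τ g))
... | no ρ≢τ   = V.trans (coeffV-dropKey-other ρ≢τ f) (V.trans (f≈g ρ) (V.sym (coeffV-dropKey-other ρ≢τ g)))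

-- Induction on the number of terms, collecting all terms with the key τ of a first term at once.
pairing-resp-≈C : (w : Weight) (f g : Sym) → f ≈C g → pairing w f ≈V pairing w g
pairing-resp-≈C w f g = bounded (length f + length g) f g ℕ.≤-refl
  where
  by-key : (τ : List ℕ) (f g : Sym) → f ≈C g → pairing w (dropKey τ f) ≈V pairing w (dropKey τ g) →
           pairing w f ≈V pairing w g
  by-key τ f g f≈g rest = begin
    pairing w f                                            ≈⟨ pairing-dropKey w τ f ⟩
    coeffV f τ *V w τ +V pairing w (dropKey τ f)           ≈⟨ V.+-cong (V.*-cong (f≈g τ) V.refl) rest ⟩
    coeffV g τ *V w τ +V pairing w (dropKey τ g)           ≈⟨ V.sym (pairing-dropKey w τ g) ⟩
    pairing w g                                            ∎
    where open SetoidReasoning V.setoid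

  bounded : (n : ℕ) (f g : Sym) → length f + length g ≤ n → f ≈C g → pairing w f ≈V pairing w g
  bounded n       []            []            _  _   = V.refl
  bounded (suc n) ((c , τ) ∷ f) g             le f≈g = by-key τ ((c , τ) ∷ f) g f≈g
    (bounded n (dropKey τ ((c , τ) ∷ f)) (dropKey τ g) shorter (dropKey-≈C τ ((c , τ) ∷ f) g f≈g))
    where
    shorter : length (dropKey τ ((c , τ) ∷ f)) + length (dropKey τ g) ≤ n
    shorter rewrite dropKey-head τ c f = ℕ.≤-trans (ℕ.+-mono-≤ (length-dropKey τ f) (length-dropKey τ g)) (ℕ.≤-pred le)
  bounded (suc n) []            ((d , τ) ∷ g) le f≈g = by-key τ [] ((d , τ) ∷ g) f≈g
    (bounded n [] (dropKey τ ((d , τ) ∷ g)) shorter (dropKey-≈C τ [] ((d , τ) ∷ g) f≈g))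
    where
    shorter : length (dropKey τ ((d , τ) ∷ g)) ≤ n
    shorter rewrite dropKey-head τ d g = ℕ.≤-trans (length-dropKey τ g) (ℕ.≤-pred le)

coeffV-++ : (f g : Sym) (ρ : List ℕ) → coeffV (f ++ g) ρ ≈V coeffV f ρ +V coeffV g ρ
coeffV-++ f g ρ = V∑.∑-++ f g _

coeffV-scaleS : (a : Frac) → ValidF a → {h : Sym} → ValidS h → (ρ : List ℕ) → coeffV (scaleS a h) ρ ≈V toV a *V coeffV h ρ
coeffV-scaleS a a-valid {h} h-valid ρ = begin
  coeffV (scaleS a h) ρ          ≈⟨ coeffV≈pairing-δ (scaleS a h) ρ ⟩
  pairing (δ ρ) (scaleS a h)     ≈⟨ pairing-scaleS (δ ρ) a a-valid h-valid ⟩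
  toV a *V pairing (δ ρ) h       ≈⟨ V.*-cong V.refl (V.sym (coeffV≈pairing-δ h ρ)) ⟩
  toV a *V coeffV h ρ            ∎
  where open SetoidReasoning V.setoid

*-pairing : (a : ValidFrac) (w : Weight) (f : Sym) → a *V pairing w f ≈V pairing (λ σ → a *V w σ) f
*-pairing a w f = V.trans (V∑.*-∑ a f _) (V∑.∑-cong f (λ (c , σ) → *-x∙yz≈y∙xz a (toV c) (w σ)))

∑-pairing : {X : Set} (xs : List X) (w : X → Weight) (f : Sym) →
            V∑.∑ xs (λ x → pairing (w x) f) ≈V pairing (λ σ → V∑.∑ xs (λ x → w x σ)) f
∑-pairing xs w f = V.trans (V∑.∑-comm xs f _) (V∑.∑-cong f (λ (c , σ) → V.sym (V∑.*-∑ (toV c) xs (λ x → w x σ))))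

-- Linear operators

single : List ℕ → Sym
single σ = (1F , σ) ∷ []

valid-single : (σ : List ℕ) → ValidS (single σ)
valid-single σ = valid-1F ∷ []

pairing-single : (w : Weight) (σ : List ℕ) → pairing w (single σ) ≈V w σ
pairing-single w σ = V.trans (V.+-identityʳ _) (V.trans (V.*-cong toV-1F V.refl) (V.*-identityˡ (w σ)))

bindS-congᴬ : {t t′ : List ℕ → Sym} → (∀ σ → ValidS (t σ)) → (∀ σ → ValidS (t′ σ)) →
              {f : Sym} → ValidS f → All (λ (_ , σ) → t σ ≈C t′ σ) f → bindS t f ≈C bindS t′ f
bindS-congᴬ t-valid t′-valid {f} f-valid t≈t′ ρ =
  V.trans (coeffV-bindS t-valid f-valid ρ)
    (V.trans (pairing-congᴬ f (All.map (λ e → e ρ) t≈t′)) (V.sym (coeffV-bindS t′-valid f-valid ρ)))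

record Linear (T : Sym → Sym) : Set where
  field
    valid  : {f : Sym} → ValidS f → ValidS (T f)
    expand : {f : Sym} → ValidS f → T f ≈C bindS (T ∘ single) f

  basis-valid : (σ : List ℕ) → ValidS (T (single σ))
  basis-valid σ = valid (valid-single σ)

  coeffV-expand : {f : Sym} → ValidS f → (ρ : List ℕ) → coeffV (T f) ρ ≈V pairing (λ σ → coeffV (T (single σ)) ρ) f
  coeffV-expand f-valid ρ = V.trans (expand f-valid ρ) (coeffV-bindS basis-valid f-valid ρ)

  resp : {f g : Sym} → ValidS f → ValidS g → f ≈C g → T f ≈C T g
  resp {f} {g} f-valid g-valid f≈g ρ =
    V.trans (coeffV-expand f-valid ρ) (V.trans (pairing-resp-≈C _ f g f≈g) (V.sym (coeffV-expand g-valid ρ)))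

  bindS-linear : {t : List ℕ → Sym} → (∀ σ → ValidS (t σ)) → {f : Sym} → ValidS f → T (bindS t f) ≈C bindS (T ∘ t) f
  bindS-linear {t} t-valid {f} f-valid ρ = begin
    coeffV (T (bindS t f)) ρ                          ≈⟨ coeffV-expand (valid-bindS t-valid f-valid) ρ ⟩
    pairing w (bindS t f)                             ≈⟨ pairing-bindS w t-valid f-valid ⟩
    pairing (λ μ → pairing w (t μ)) f                 ≈⟨ pairing-cong f (λ μ → V.sym (coeffV-expand (t-valid μ) ρ)) ⟩
    pairing (λ μ → coeffV (T (t μ)) ρ) f              ≈⟨ V.sym (coeffV-bindS (λ μ → valid (t-valid μ)) f-valid ρ) ⟩
    coeffV (bindS (T ∘ t) f) ρ                        ∎
    where
    open SetoidReasoning V.setoid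
    w : Weight
    w σ = coeffV (T (single σ)) ρ

open Linear

Linear-id : Linear (λ f → f)
Linear-id = record { valid = λ f-valid → f-valid ; expand = expand-id }
  where
  expand-id : {f : Sym} → ValidS f → f ≈C bindS single f
  expand-id {f} f-valid ρ = begin
    coeffV f ρ                                ≈⟨ coeffV≈pairing-δ f ρ ⟩
    pairing (δ ρ) f
      ≈⟨ pairing-cong f (λ σ → V.sym (V.trans (coeffV≈pairing-δ (single σ) ρ) (pairing-single (δ ρ) σ))) ⟩
    pairing (λ σ → coeffV (single σ) ρ) f     ≈⟨ V.sym (coeffV-bindS valid-single f-valid ρ) ⟩
    coeffV (bindS single f) ρ                 ∎
    where open SetoidReasoning V.setoid

Linear-∘ : {T₁ T₂ : Sym → Sym} → Linear T₁ → Linear T₂ → Linear (T₂ ∘ T₁)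
Linear-∘ {T₁} {T₂} L₁ L₂ = record
  { valid  = valid L₂ ∘ valid L₁
  ; expand = λ {f} f-valid → ≈C-trans {T₂ (T₁ f)} {T₂ (bindS (T₁ ∘ single) f)} {bindS (T₂ ∘ T₁ ∘ single) f}
      (resp L₂ (valid L₁ f-valid) (valid-bindS (basis-valid L₁) f-valid) (expand L₁ f-valid))
      (bindS-linear L₂ (basis-valid L₁) f-valid) }

Linear-scaleS : (a : Frac) → ValidF a → {T : Sym → Sym} → Linear T → Linear (scaleS a ∘ T)
Linear-scaleS a a-valid {T} L = record
  { valid  = valid-scaleS a a-valid ∘ valid L
  ; expand = λ {f} f-valid ρ → begin
      coeffV (scaleS a (T f)) ρ                               ≈⟨ coeffV-scaleS a a-valid (valid L f-valid) ρ ⟩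
      toV a *V coeffV (T f) ρ                                 ≈⟨ V.*-cong V.refl (coeffV-expand L f-valid ρ) ⟩
      toV a *V pairing (λ σ → coeffV (T (single σ)) ρ) f      ≈⟨ *-pairing (toV a) _ f ⟩
      pairing (λ σ → toV a *V coeffV (T (single σ)) ρ) f
        ≈⟨ pairing-cong f (λ σ → V.sym (coeffV-scaleS a a-valid (basis-valid L σ) ρ)) ⟩
      pairing (λ σ → coeffV (scaleS a (T (single σ))) ρ) f
        ≈⟨ V.sym (coeffV-bindS (valid-scaleS a a-valid ∘ basis-valid L) f-valid ρ) ⟩
      coeffV (bindS (scaleS a ∘ T ∘ single) f) ρ              ∎ }
  where open SetoidReasoning V.setoid

valid-concatMap : {X : Set} (g : X → Sym) {xs : List X} → All (ValidS ∘ g) xs → ValidS (concatMap g xs)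
valid-concatMap g = All.concat⁺ ∘ All.map⁺

Linear-concatMap : {X : Set} {T : X → Sym → Sym} {xs : List X} → All (λ x → Linear (T x)) xs →
                   Linear (λ f → concatMap (λ x → T x f) xs)
Linear-concatMap {X} {T} {xs} Ls = record
  { valid  = λ f-valid → valid-concatMap _ (All.map (λ L → valid L f-valid) Ls)
  ; expand = λ {f} f-valid ρ → begin
      coeffV (concatMap (λ x → T x f) xs) ρ                          ≈⟨ V∑.∑-concatMap (λ x → T x f) xs _ ⟩
      V∑.∑ xs (λ x → coeffV (T x f) ρ)                               ≈⟨ V∑.∑-congᴬ Ls (λ x L → coeffV-expand L f-valid ρ) ⟩
      V∑.∑ xs (λ x → pairing (λ σ → coeffV (T x (single σ)) ρ) f)    ≈⟨ ∑-pairing xs _ f ⟩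
      pairing (λ σ → V∑.∑ xs (λ x → coeffV (T x (single σ)) ρ)) f
        ≈⟨ pairing-cong f (λ σ → V.sym (V∑.∑-concatMap (λ x → T x (single σ)) xs _)) ⟩
      pairing (λ σ → coeffV (concatMap (λ x → T x (single σ)) xs) ρ) f
        ≈⟨ V.sym (coeffV-bindS (λ σ → valid-concatMap _ (All.map (λ L → basis-valid L σ) Ls)) f-valid ρ) ⟩
      coeffV (bindS (λ σ → concatMap (λ x → T x (single σ)) xs) f) ρ ∎ }
  where open SetoidReasoning V.setoid

Linear-termwise : (k : Frac → List ℕ → Frac) (h : List ℕ → List ℕ) →
  (∀ {d} σ → ValidF d → ValidF (k d σ)) →
  (∀ {d} σ → ValidF d → toV (k d σ) ≈V toV d *V toV (k 1F σ)) →
  Linear (map (λ (d , σ) → (k d σ , h σ)))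
Linear-termwise k h k-valid k-linear = record
  { valid  = All.map⁺ ∘ All.map (λ {(d , σ)} → k-valid σ)
  ; expand = λ {f} f-valid ρ → begin
      coeffV (map F f) ρ                                     ≡⟨ V∑.∑-map F f _ ⟩
      V∑.∑ f (λ t → term (F t) ρ)                            ≈⟨ V∑.∑-congᴬ f-valid (λ (d , σ) → term-linear ρ d σ) ⟩
      pairing (λ σ → coeffV (map F (single σ)) ρ) f            ≈⟨ V.sym (coeffV-bindS (λ σ → k-valid σ valid-1F ∷ []) f-valid ρ) ⟩
      coeffV (bindS (λ σ → map F (single σ)) f) ρ            ∎ }
  where
  open SetoidReasoning V.setoid
  F : Frac × List ℕ → Frac × List ℕ
  F (d , σ) = (k d σ , h σ)
  term-linear : (ρ : List ℕ) (d : Frac) (σ : List ℕ) → ValidF d → term (F (d , σ)) ρ ≈V toV d *V (term (F (1F , σ)) ρ +V 0V)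
  term-linear ρ d σ d-valid with does (h σ ≟ₗ ρ)
  ... | true  = V.trans (k-linear σ d-valid) (V.*-cong V.refl (V.sym (V.+-identityʳ _)))
  ... | false = V.sym (V.trans (V.*-cong V.refl (V.+-identityʳ 0V)) (V.zeroʳ (toV d)))

-- The operators of the paper

valid-polyF : (p : Poly) → ValidF (polyF p)
valid-polyF p = valid-1F

toV-1F*F : (a : Frac) → ValidF a → toV (1F *F a) ≈V toV a
toV-1F*F a a-valid = V.trans (toV-*F 1F a valid-1F a-valid) (V.trans (V.*-cong toV-1F V.refl) (V.*-identityˡ (toV a)))

Linear-dS : (n : ℕ) → Linear (dS n)
Linear-dS n = Linear-termwise (λ d σ → d *F natF (count n σ)) (remove1 n)
  (λ {d} σ d-valid → valid-*F {d} {natF (count n σ)} d-valid valid-1F)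
  (λ {d} σ d-valid → V.trans (toV-*F d (natF (count n σ)) d-valid valid-1F)
                       (V.*-cong V.refl (V.sym (toV-1F*F (natF (count n σ)) valid-1F))))

Linear-pPerp : (ρ : List ℕ) → Linear (pPerp ρ)
Linear-pPerp []      = Linear-id
Linear-pPerp (n ∷ ρ) = Linear-∘ (Linear-pPerp ρ) (Linear-scaleS (natF n) (valid-polyF (constP (+ n))) (Linear-dS n))

zee-pos : (ρ : List ℕ) → 0 < zee ρ
zee-pos ρ = >-nonZero⁻¹ (zee ρ) {{product≢0 (All.map⁺ (All.map⁺ (All.universal factor≢0 (upTo (sum ρ)))))}}
  where
  factor≢0 : (j : ℕ) → NonZero (suc j ^ count (suc j) ρ * count (suc j) ρ !)
  factor≢0 j = ℕ.m*n≢0 _ _ {{ℕ.m^n≢0 (suc j) (count (suc j) ρ)}} {{count (suc j) ρ ℕ.!≢0}}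

constP-zee≉0 : (ρ : List ℕ) → ¬ constP (+ zee ρ) ≈P []
constP-zee≉0 ρ with zee ρ | zee-pos ρ
... | suc k | _ = constP-suc≉0 k

valid-plethCoef : (ρ : List ℕ) → ValidF (plethCoef ρ)
valid-plethCoef = constP-zee≉0

valid-schurZ : (n : ℤ) → ValidS (schurZ n)
valid-schurZ (+ m)    = All.map⁺ (All.universal constP-zee≉0 (partitionsOf m))
valid-schurZ -[1+ m ] = []

Linear-skewT : (i : ℕ) → Linear (skewT i)
Linear-skewT i = Linear-concatMap
  (All.universal (λ ρ → Linear-scaleS (plethCoef ρ) (valid-plethCoef ρ) (Linear-pPerp ρ)) (partitionsOf i))

toV-*F1F : (a : Frac) → ValidF a → toV (a *F 1F) ≈V toV a
toV-*F1F a a-valid = V.trans (toV-*F a 1F a-valid valid-1F) (V.trans (V.*-cong V.refl toV-1F) (V.*-identityʳ (toV a)))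

Linear-mulS-monomial : (c : Frac) → ValidF c → (ρ : List ℕ) → Linear (map (λ (d , σ) → (c *F d , mergeD ρ σ)))
Linear-mulS-monomial c c-valid ρ = Linear-termwise (λ d σ → c *F d) (mergeD ρ)
  (λ {d} σ d-valid → valid-*F {c} {d} c-valid d-valid)
  (λ {d} σ d-valid → V.trans (toV-*F c d c-valid d-valid)
                       (V.trans (V.*-comm (toV c) (toV d)) (V.*-cong V.refl (V.sym (toV-*F1F c c-valid)))))

Linear-mulS : {s : Sym} → ValidS s → Linear (mulS s)
Linear-mulS s-valid = Linear-concatMap (All.map (λ {(c , ρ)} c-valid → Linear-mulS-monomial c c-valid ρ) s-valid)

-- B_n with the sum over i truncated at D, so that Bop n f = BopD (degS f) n f.
BopD : ℕ → ℤ → Sym → Sym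
BopD D n f = concatMap (λ i → mulS (schurZ ((+ i) +ℤ n)) (skewT i f)) (upTo (suc D))

Linear-BopD : (D : ℕ) (n : ℤ) → Linear (BopD D n)
Linear-BopD D n = Linear-concatMap
  (All.universal (λ i → Linear-∘ (Linear-skewT i) (Linear-mulS (valid-schurZ ((+ i) +ℤ n)))) (upTo (suc D)))

constP-0≈0 : constP (+ 0) ≈P []
constP-0≈0 a b with (0 ≡ᵇ a) ∧ (0 ≡ᵇ b)
... | true  = refl
... | false = refl

*P-≈P[]ʳ : (p r : Poly) → r ≈P [] → (p *P r) ≈P []
*P-≈P[]ʳ p r r≈0 = ≋⇒≈P (Poly.trans (Poly.*-cong (Poly.refl {p}) (≈P⇒≋ {r} {[]} r≈0)) (Poly.zeroʳ p))

*P-≈P[]ˡ : (p r : Poly) → p ≈P [] → (p *P r) ≈P []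
*P-≈P[]ˡ p r p≈0 = ≋⇒≈P (Poly.trans (Poly.*-cong (≈P⇒≋ {p} {[]} p≈0) (Poly.refl {r})) (Poly.zeroˡ r))

sum-remove1 : (n : ℕ) (σ : List ℕ) → count n σ ≢ 0 → sum (remove1 n σ) + n ≡ sum σ
sum-remove1 n []      n∉σ = ⊥-elim (n∉σ refl)
sum-remove1 n (m ∷ σ) n∈σ with n ≟ m
... | yes refl rewrite dec-true (n ≟ n) refl = ℕ.+-comm (sum σ) n
... | no n≢m   rewrite dec-false (n ≟ m) n≢m =
  trans (ℕ.+-assoc m (sum (remove1 n σ)) n) (cong (λ k → m + k) (sum-remove1 n σ n∈σ))

pPerp-monomial : (ρ σ : List ℕ) (c : Frac) → ∃ λ c′ → ∃ λ σ′ →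
  pPerp ρ ((c , σ) ∷ []) ≡ (c′ , σ′) ∷ [] × (num c′ ≈P [] ⊎ sum σ′ + sum ρ ≡ sum σ)
pPerp-monomial []      σ c = c , σ , refl , inj₂ (ℕ.+-identityʳ (sum σ))
pPerp-monomial (n ∷ ρ) σ c with pPerp-monomial ρ σ c
... | c′ , σ′ , eq , inv rewrite eq = _ , remove1 n σ′ , refl , step inv
  where
  k : ℕ
  k = count n σ′
  step : num c′ ≈P [] ⊎ sum σ′ + sum ρ ≡ sum σ →
         num (natF n *F (c′ *F natF k)) ≈P [] ⊎ sum (remove1 n σ′) + (n + sum ρ) ≡ sum σ
  step (inj₁ c′≈0) = inj₁ (*P-≈P[]ʳ (constP (+ n)) (num c′ *P constP (+ k)) (*P-≈P[]ˡ (num c′) (constP (+ k)) c′≈0))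
  step (inj₂ deg) with k ≟ 0
  ... | yes n∉σ′ = inj₁ (*P-≈P[]ʳ (constP (+ n)) (num c′ *P constP (+ k))
                          (*P-≈P[]ʳ (num c′) (constP (+ k)) (subst (λ i → constP (+ i) ≈P []) (sym n∉σ′) constP-0≈0)))
  ... | no  n∈σ′ = inj₂ (begin
    sum (remove1 n σ′) + (n + sum ρ)   ≡⟨ sym (ℕ.+-assoc (sum (remove1 n σ′)) n (sum ρ)) ⟩
    sum (remove1 n σ′) + n + sum ρ     ≡⟨ cong (_+ sum ρ) (sum-remove1 n σ′ n∈σ′) ⟩
    sum σ′ + sum ρ                     ≡⟨ deg ⟩
    sum σ                              ∎)
    where open ≡-Reasoning

monomial≈C[] : (c : Frac) (σ : List ℕ) → num c ≈P [] → ((c , σ) ∷ []) ≈C []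
monomial≈C[] c σ c≈0 τ with does (σ ≟ₗ τ)
... | true  = V.trans (V.+-identityʳ (toV c)) (toV-zero c c≈0)
... | false = V.+-identityʳ 0V

pPerp-vanishes : (ρ σ : List ℕ) → sum σ < sum ρ → pPerp ρ (single σ) ≈C []
pPerp-vanishes ρ σ σ<ρ with pPerp-monomial ρ σ 1F
... | c′ , σ′ , eq , inj₁ c′≈0 rewrite eq = monomial≈C[] c′ σ′ c′≈0
... | c′ , σ′ , eq , inj₂ deg =
  ⊥-elim (ℕ.<-irrefl refl (ℕ.<-≤-trans σ<ρ (subst (sum ρ ≤_) deg (ℕ.m≤n+m (sum ρ) (sum σ′)))))

sum-partsB : (fuel m b : ℕ) → All (λ ρ → sum ρ ≡ m) (partsB fuel m b)
sum-partsB fuel       zero    b = refl ∷ []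
sum-partsB zero       (suc m) b = []
sum-partsB (suc fuel) (suc m) b = All.concat⁺ (All.map⁺ (All.map (λ {a} a≤m →
    All.map⁺ (All.map (λ e → trans (cong (λ k → a + k) e) (ℕ.m+[n∸m]≡n {a} a≤m)) (sum-partsB fuel (suc m ∸ a) a)))
  (All.map⁺ (All.applyUpTo⁺₁ (λ i → i) (suc m ⊓ b) (λ i<m⊓b → ℕ.≤-trans i<m⊓b (ℕ.m⊓n≤m (suc m) b))))))

skewT-vanishes : (i : ℕ) (σ : List ℕ) → sum σ < i → skewT i (single σ) ≈C []
skewT-vanishes i σ σ<i τ = begin
  coeffV (skewT i (single σ)) τ                                               ≈⟨ V∑.∑-concatMap _ (partitionsOf i) _ ⟩
  V∑.∑ (partitionsOf i) (λ ρ → coeffV (scaleS (plethCoef ρ) (pPerp ρ (single σ))) τ)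
    ≈⟨ V∑.∑-congᴬ (sum-partsB i i i) (λ ρ ρ⊢i → V.trans
         (coeffV-scaleS (plethCoef ρ) (valid-plethCoef ρ) (basis-valid (Linear-pPerp ρ) σ) τ)
         (V.trans (V.*-cong V.refl (pPerp-vanishes ρ σ (subst (sum σ <_) (sym ρ⊢i) σ<i) τ)) (V.zeroʳ _))) ⟩
  V∑.∑ (partitionsOf i) (λ _ → 0V)                                            ≈⟨ V∑.∑-zero (partitionsOf i) (λ _ → V.refl) ⟩
  0V                                                                          ∎
  where open SetoidReasoning V.setoid

BopD-suc : (D : ℕ) (n : ℤ) (g : Sym) →
           BopD (suc D) n g ≡ BopD D n g ++ (mulS (schurZ ((+ suc D) +ℤ n)) (skewT (suc D) g) ++ [])
BopD-suc D n g = trans (cong (concatMap F) (sym (List.applyUpTo-∷ʳ (λ i → i) (suc D))))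
                       (List.concatMap-++ F (upTo (suc D)) (suc D ∷ []))
  where
  F : ℕ → Sym
  F i = mulS (schurZ ((+ i) +ℤ n)) (skewT i g)

mulS-[] : (s : Sym) → mulS s [] ≡ []
mulS-[] []      = refl
mulS-[] (_ ∷ s) = mulS-[] s

BopD-extend : (n : ℤ) (σ : List ℕ) {D : ℕ} → sum σ ≤ D → BopD (suc D) n (single σ) ≈C BopD D n (single σ)
BopD-extend n σ {D} σ≤D τ rewrite BopD-suc D n (single σ) = begin
  coeffV (BopD D n (single σ) ++ (X ++ [])) τ      ≈⟨ coeffV-++ (BopD D n (single σ)) (X ++ []) τ ⟩
  coeffV (BopD D n (single σ)) τ +V coeffV (X ++ []) τ
    ≈⟨ V.+-cong V.refl (V.trans (coeffV-++ X [] τ) (V.trans (V.+-identityʳ _) (X≈[] τ))) ⟩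
  coeffV (BopD D n (single σ)) τ +V 0V             ≈⟨ V.+-identityʳ _ ⟩
  coeffV (BopD D n (single σ)) τ                   ∎
  where
  open SetoidReasoning V.setoid
  s : Sym
  s = schurZ ((+ suc D) +ℤ n)
  X : Sym
  X = mulS s (skewT (suc D) (single σ))
  X≈[] : X ≈C []
  X≈[] = subst (X ≈C_) (mulS-[] s)
    (resp (Linear-mulS (valid-schurZ ((+ suc D) +ℤ n))) (basis-valid (Linear-skewT (suc D)) σ) []
          (skewT-vanishes (suc D) σ (s≤s σ≤D)))

BopD-stable : (n : ℤ) (σ : List ℕ) (D : ℕ) → sum σ ≤ D → BopD D n (single σ) ≈C Bop n (single σ)
BopD-stable n σ D σ≤D with ℕ.m≤n⇒m<n∨m≡n σ≤D
... | inj₂ refl rewrite ℕ.⊔-identityʳ (sum σ) = λ _ → V.refl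
BopD-stable n σ (suc D) _ | inj₁ (s≤s σ≤D) =
  ≈C-trans {BopD (suc D) n (single σ)} {BopD D n (single σ)} {Bop n (single σ)}
           (BopD-extend n σ σ≤D) (BopD-stable n σ D σ≤D)

degS-bound : (f : Sym) → All (λ (_ , σ) → sum σ ≤ degS f) f
degS-bound []            = []
degS-bound ((c , σ) ∷ f) =
  ℕ.m≤m⊔n (sum σ) (degS f) ∷ All.map (λ le → ℕ.≤-trans le (ℕ.m≤n⊔m (sum σ) (degS f))) (degS-bound f)

Linear-Bop : (n : ℤ) → Linear (Bop n)
Linear-Bop n = record
  { valid  = λ {f} → valid (Linear-BopD (degS f) n)
  ; expand = λ {f} f-valid → ≈C-trans {Bop n f} {bindS (BopD (degS f) n ∘ single) f} {bindS (Bop n ∘ single) f}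
      (expand (Linear-BopD (degS f) n) f-valid)
      (bindS-congᴬ (basis-valid (Linear-BopD (degS f) n)) Bop-basis-valid f-valid
        (All.map (λ {(_ , σ)} → BopD-stable n σ (degS f)) (degS-bound f))) }
  where
  Bop-basis-valid : (σ : List ℕ) → ValidS (Bop n (single σ))
  Bop-basis-valid σ = basis-valid (Linear-BopD (degS (single σ)) n) σ

Linear-Bseq : (ν : List ℤ) → Linear (Bseq ν)
Linear-Bseq []      = Linear-id
Linear-Bseq (n ∷ ν) = Linear-∘ (Linear-Bseq ν) (Linear-Bop n)

Linear-Bμ : (μ : List ℕ) → Linear (Bμ μ)
Linear-Bμ μ = Linear-concatMap (All.universal summand (subsets (pairsLt (length μ))))
  where
  summand : (S : List (ℕ × ℕ)) → Linear (scaleS (polyF (powP (negP tP) (length S))) ∘ Bseq (applyPairs S (map +_ μ)))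
  summand S = Linear-scaleS (polyF (powP (negP tP) (length S))) (valid-polyF (powP (negP tP) (length S)))
                            (Linear-Bseq (applyPairs S (map +_ μ)))

-- k-split polynomials

Gfuel-enough : (a b k : ℕ) (μ : List ℕ) → length μ ≤ a → length μ ≤ b → Gfuel a k μ ≡ Gfuel b k μ
Gfuel-enough a       b       k []      _         _         = refl
Gfuel-enough (suc a) (suc b) k (x ∷ μ) (s≤s μ≤a) (s≤s μ≤b) =
  cong (Bμ (take (suc (k ∸ x)) (x ∷ μ))) (Gfuel-enough a b k (drop (k ∸ x) μ) (shorter μ≤a) (shorter μ≤b))
  where
  shorter : ∀ {c} → length μ ≤ c → length (drop (k ∸ x) μ) ≤ c
  shorter μ≤c = ℕ.≤-trans (ℕ.≤-reflexive (List.length-drop (k ∸ x) μ)) (ℕ.≤-trans (ℕ.m∸n≤m (length μ) (k ∸ x)) μ≤c)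

take-length-++ : (xs ys : List ℕ) → take (length xs) (xs ++ ys) ≡ xs
take-length-++ []       ys = refl
take-length-++ (x ∷ xs) ys = cong (x ∷_) (take-length-++ xs ys)

drop-length-++ : (xs ys : List ℕ) → drop (length xs) (xs ++ ys) ≡ ys
drop-length-++ []       ys = refl
drop-length-++ (x ∷ xs) ys = drop-length-++ xs ys

G-++ : (k m : ℕ) (l μ : List ℕ) → m + length (m ∷ l) ≡ suc k → G k ((m ∷ l) ++ μ) ≡ Bμ (m ∷ l) (G k μ)
G-++ k m l μ hook = begin
  G k ((m ∷ l) ++ μ)
    ≡⟨⟩
  Bμ (take (suc (k ∸ m)) (m ∷ l ++ μ)) (Gfuel (length (l ++ μ)) k (drop (k ∸ m) (l ++ μ)))
    ≡⟨ cong (λ i → Bμ (take (suc i) (m ∷ l ++ μ)) (Gfuel (length (l ++ μ)) k (drop i (l ++ μ)))) k∸m≡l ⟩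
  Bμ (m ∷ take (length l) (l ++ μ)) (Gfuel (length (l ++ μ)) k (drop (length l) (l ++ μ)))
    ≡⟨ cong₂ (λ l′ μ′ → Bμ (m ∷ l′) (Gfuel (length (l ++ μ)) k μ′)) (take-length-++ l μ) (drop-length-++ l μ) ⟩
  Bμ (m ∷ l) (Gfuel (length (l ++ μ)) k μ)
    ≡⟨ cong (Bμ (m ∷ l)) (Gfuel-enough (length (l ++ μ)) (length μ) k μ (List.length-++-≤ʳ μ {l}) ℕ.≤-refl) ⟩
  Bμ (m ∷ l) (G k μ) ∎
  where
  open ≡-Reasoning
  k∸m≡l : k ∸ m ≡ length l
  k∸m≡l = begin
    k ∸ m                ≡⟨ cong (_∸ m) (ℕ.suc-injective (trans (sym hook) (ℕ.+-suc m (length l)))) ⟩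
    (m + length l) ∸ m   ≡⟨ ℕ.m+n∸m≡n m (length l) ⟩
    length l             ∎

valid-G : (k : ℕ) (μ : List ℕ) → ValidS (G k μ)
valid-G k μ = valid-Gfuel (length μ) μ
  where
  valid-Gfuel : (fuel : ℕ) (μ : List ℕ) → ValidS (Gfuel fuel k μ)
  valid-Gfuel _          []      = valid-single []
  valid-Gfuel zero       (_ ∷ _) = valid-single []
  valid-Gfuel (suc fuel) (x ∷ μ) = valid (Linear-Bμ (take (suc (k ∸ x)) (x ∷ μ))) (valid-Gfuel fuel (drop (suc (k ∸ x)) (x ∷ μ)))

Linked-++ : (x : ℕ) (xs μ : List ℕ) → Linked (λ a b → b ≤ a) (x ∷ xs) → Linked (λ a b → b ≤ a) μ →
            headP μ ≤ lastP (x ∷ xs) → Linked (λ a b → b ≤ a) ((x ∷ xs) ++ μ)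
Linked-++ x []       []      _              _      _  = [-]
Linked-++ x []       (y ∷ μ) _              μ-desc y≤x = y≤x ∷ μ-desc
Linked-++ x (y ∷ xs) μ       (y≤x ∷ xs-desc) μ-desc μ≤ = y≤x ∷ Linked-++ y xs μ xs-desc μ-desc μ≤

IsPartition-++ : (x : ℕ) (xs μ : List ℕ) → IsPartition (x ∷ xs) → IsPartition μ →
                 headP μ ≤ lastP (x ∷ xs) → IsPartition ((x ∷ xs) ++ μ)
IsPartition-++ x xs μ (pos , desc) (μ-pos , μ-desc) μ≤ = All.++⁺ pos μ-pos , Linked-++ x xs μ desc μ-desc μ≤

prependRows : List ℕ → List (Frac × List ℕ) → List (Frac × List ℕ)
prependRows λ′ = map (λ (c , μ) → (c , λ′ ++ μ))

evalG-prependRows : (k m : ℕ) (l : List ℕ) → m + length (m ∷ l) ≡ suc k → (cs : List (Frac × List ℕ)) →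
                    evalG k (prependRows (m ∷ l) cs) ≡ bindS (Bμ (m ∷ l) ∘ G k) cs
evalG-prependRows k m l hook cs =
  trans (List.concatMap-map _ _ cs) (List.concatMap-cong (λ (c , μ) → cong (scaleS c) (G-++ k m l μ hook)) cs)

Bμ-evalG : (k m : ℕ) (l : List ℕ) → m + length (m ∷ l) ≡ suc k → {f : Sym} → ValidS f →
           (cs : List (Frac × List ℕ)) → All (λ (c , _) → ValidF c) cs →
           f ≈S evalG k cs → Bμ (m ∷ l) f ≈S evalG k (prependRows (m ∷ l) cs)
Bμ-evalG k m l hook {f} f-valid cs cs-valid f≈cs = ≈C⇒≈S (valid B f-valid) evalG′-valid $
  ≈C-trans {Bμ (m ∷ l) f} {Bμ (m ∷ l) (evalG k cs)} {evalG k (prependRows (m ∷ l) cs)}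
    (resp B f-valid evalG-valid (≈S⇒≈C f-valid evalG-valid f≈cs))
    (subst (Bμ (m ∷ l) (evalG k cs) ≈C_) (sym (evalG-prependRows k m l hook cs)) (bindS-linear B (valid-G k) cs-valid))
  where
  B : Linear (Bμ (m ∷ l))
  B = Linear-Bμ (m ∷ l)
  evalG-valid : ValidS (evalG k cs)
  evalG-valid = valid-bindS (valid-G k) cs-valid
  evalG′-valid : ValidS (evalG k (prependRows (m ∷ l) cs))
  evalG′-valid = subst ValidS (sym (evalG-prependRows k m l hook cs)) (valid-bindS (valid B ∘ valid-G k) cs-valid)

head≤hook : (m : ℕ) (l : List ℕ) {k : ℕ} → m + length (m ∷ l) ≡ suc k → m ≤ k
head≤hook m l hook =
  ℕ.≤-trans (ℕ.m≤m+n m (length l)) (ℕ.≤-reflexive (ℕ.suc-injective (trans (sym (ℕ.+-suc m (length l))) hook)))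

lemma5 : (k : ℕ) → 1 ≤ k → (j : ℕ) → (λ' : List ℕ) → IsPartition λ'
       → headP λ' + length λ' ≡ suc k
       → j ≤ lastP λ'
       → (f : Sym) → ValidS f → InΩ k j f
       → InΩ k (headP λ') (Bμ λ' f)
lemma5 k _ j []      _           ()   _      _ _       _
lemma5 k _ j (m ∷ l) λ-partition hook j≤last f f-valid (cs , cs-ok , f≈cs) =
    prependRows (m ∷ l) cs
  , All.map⁺ (All.map (λ {x} → prepend-ok {x}) cs-ok)
  , Bμ-evalG k m l hook f-valid cs (All.map proj₁ cs-ok) f≈cs
  where
  prepend-ok : {(c , μ) : Frac × List ℕ} → ValidF c × IsPartition μ × headP μ ≤ k × headP μ ≡ j →
               ValidF c × IsPartition ((m ∷ l) ++ μ) × m ≤ k × m ≡ m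
  prepend-ok {_ , μ} (c-valid , μ-partition , _ , refl) =
    c-valid , IsPartition-++ m l μ λ-partition μ-partition j≤last , head≤hook m l hook , refl
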